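{- Let $t$ and $c$ be positive integers. Let $G$ be a graph and $T_1,\ldots,T_t$ even-cardinality subsets of $V(G)$ such that a $(T_1,\ldots,T_t)$-even cut exists, and let $k$ be the minimum size of a $(T_1,\ldots,T_t)$-even cut. If the Random Contraction Algorithm (described below) is run independently $c|V(G)|^4$ times on $(G;T_1,\ldots,T_t)$, the probability that none of the runs returns a $(T_1,\ldots,T_t)$-even cut of size $k$ is at most $e^{ -24c}$.
   Context: For $X\subseteq V(G)$, $\delta_G(X)$ is the set of edges with one end in $X$ and the other outside $X$. A $(T_1,\ldots,T_t)$-even cut is a set $\delta_G(X)$ with $\emptyset\subsetneq X\subsetneq V(G)$ and $|T_i\cap X|$ even for all $i$. For an edge $e$ with ends $x,y$, let $G/e$ be obtained by contracting $e$ to a new vertex $z$, and for each $i$ let $T_i'$ be the unique even-cardinality subset of $V(G/e)$ with $T_i\setminus\{x,y\}=T_i'\setminus\{z\}$; write $(G;T_1,\ldots,T_t)/e=(G/e;T_1',\ldots,T_t')$. The Random Contraction Algorithm, on such an instance: Step 1: delete the loops of $G$. Step 2: if $|V(G)|\le 2^t+4$, find a minimum-cardinality $(T_1,\ldots,T_t)$-even cut $C$ by exhaustive search and return $C$. Step 3: if $G$ has no edge, return $\emptyset$. Step 4: choose an edge $e$ of $G$ uniformly at random, replace the instance by $(G;T_1,\ldots,T_t)/e$, and repeat from Step 1. (Edges of contracted graphs are identified with edges of the original graph.) -}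

module Defs where

open import Data.Bool using (Bool; true; false; _∧_; _xor_; not; if_then_else_)
open import Data.Nat as ℕ using (ℕ; zero; suc; _^_; _≤?_)
open import Data.Nat.Divisibility using (_∣_)
open import Data.Fin using (Fin; punchOut)
open import Data.Fin.Properties using (_≟_)
open import Data.Fin.Subset using (Subset; _∈_; _∉_; _∩_; ∣_∣; ⊤; ⊥)
open import Data.Vec using (Vec; tabulate; lookup)
open import Data.List using (List; []; _∷_; length; allFin; foldr)
open import Data.Product using (Σ; _×_; _,_; proj₁; proj₂; ∃)
open import Data.Integer using (+_)
open import Data.Rational using (ℚ; _+_; _*_; _-_; _/_; 0ℚ; 1ℚ)
open import Relation.Nullary using (Dec; yes; no; does; ¬_)
open import Relation.Binary.PropositionalEquality using (_≡_; _≢_)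

-- The ORIGINAL graph G has vertex set Fin n and edge set Fin m; edge e
-- has ends  ends e = (x , y)  (parallel edges and loops allowed).
-- Throughout the algorithm, edges of contracted graphs are identified
-- with edges of the original graph: an instance of the algorithm with
-- n' vertices consists of the set E ⊆ Fin m of (original) edges still
-- present, the ends of every original edge in the current vertex set
-- Fin n', and the t sets T_1..T_t ⊆ Fin n'.

record Inst (m t n' : ℕ) : Set where
  constructor inst
  field
    edges : Subset m
    ends  : Fin m → Fin n' × Fin n'
    Ts    : Fin t → Subset n'
open Inst public

crosses : ∀ {n' m} → (Fin m → Fin n' × Fin n') → Subset n' → Fin m → Bool
crosses ends X e = lookup X (proj₁ (ends e)) xor lookup X (proj₂ (ends e))

δ : ∀ {m t n'} → Inst m t n' → Subset n' → Subset m
δ I X = tabulate λ e → lookup (edges I) e ∧ crosses (ends I) X e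

EvenSide : ∀ {m t n'} → Inst m t n' → Subset n' → Set
EvenSide {t = t} {n'} I X =
  (∃ λ v → v ∈ X) × (∃ λ v → v ∉ X) × ((i : Fin t) → 2 ∣ (∣ Ts I i ∩ X ∣))

IsEvenCut : ∀ {m t n'} → Inst m t n' → Subset m → Set
IsEvenCut {n' = n'} I C = Σ (Subset n') λ X → EvenSide I X × δ I X ≡ C

IsMinEvenCut : ∀ {m t n'} → Inst m t n' → Subset m → Set
IsMinEvenCut {m} I C =
  IsEvenCut I C × ((D : Subset m) → IsEvenCut I D → ∣ C ∣ ℕ.≤ ∣ D ∣)

deleteLoops : ∀ {m t n'} → Inst m t n' → Inst m t n'
deleteLoops (inst E ends Ts) =
  inst (tabulate λ e → lookup E e ∧ not (does (proj₁ (ends e) ≟ proj₂ (ends e))))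
       ends Ts

NonLoop : ∀ {m n'} → (Fin m → Fin n' × Fin n') → Set
NonLoop {m} ends = Σ (Fin m) λ e → proj₁ (ends e) ≢ proj₂ (ends e)

nonLoopList : ∀ {m t n'} (I : Inst m t n') → List (Fin m) → List (NonLoop (ends I))
nonLoopList I [] = []
nonLoopList I (e ∷ es) with lookup (edges I) e | proj₁ (ends I e) ≟ proj₂ (ends I e)
... | true  | no x≢y = (e , x≢y) ∷ nonLoopList I es
... | true  | yes _  = nonLoopList I es
... | false | _      = nonLoopList I es

-- The vertex map Fin (suc p) → Fin p: y is identified with x (the
-- image of x is the new vertex z), all other vertices keep their
-- identity (renumbered by punchOut).

merge : ∀ {p} {x y : Fin (suc p)} → x ≢ y → Fin (suc p) → Fin p
merge {x = x} {y} x≢y v with v ≟ y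
... | yes _  = punchOut {i = y} {j = x} (λ y≡x → x≢y (Relation.Binary.PropositionalEquality.sym y≡x))
... | no v≢y = punchOut {i = y} {j = v} (λ y≡v → v≢y (Relation.Binary.PropositionalEquality.sym y≡v))

-- T'(w) := this parity; for w ≠ z this is T(v) for the unique preimage
-- v, and for w = z it is T(x) xor T(y): i.e. T' is exactly the unique
-- even-cardinality set with T ∖ {x,y} = T' ∖ {z}.
preimageParity : ∀ {a b} → (Fin a → Fin b) → Subset a → Fin b → Bool
preimageParity {a} f T w =
  foldr (λ v r → (lookup T v ∧ does (f v ≟ w)) xor r) false (allFin a)

contract : ∀ {m t p} (I : Inst m t (suc p)) → NonLoop (ends I) → Inst m t p
contract (inst E ends Ts) (e , x≢y) =
  inst E
       (λ f → merge x≢y (proj₁ (ends f)) , merge x≢y (proj₂ (ends f)))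
       (λ i → tabulate (preimageParity (merge x≢y) (Ts i)))

average : ∀ {A : Set} → (A → ℚ) → A → List A → ℚ
average f a as = foldr (λ b r → f b + r) (f a) as * (+ 1 / suc (length as))

-- A "search" is a way of carrying out the exhaustive search of Step 2.
Search : ℕ → ℕ → Set
Search m t = ∀ {n'} → Inst m t n' → Subset m

successProb : ∀ {m t} (Good : Subset m → Set) (good? : (C : Subset m) → Dec (Good C))
  → Search m t → (n' : ℕ) → Inst m t n' → ℚ
successProb {m} {t} Good good? search n' I = go n' I
  where
  indicator : Subset m → ℚ
  indicator C = if does (good? C) then 1ℚ else 0ℚ

  go : (n' : ℕ) → Inst m t n' → ℚ
  -- (n' = 0: Step 2 applies since 0 ≤ 2^t+4)
  go zero I₀ = indicator (search (deleteLoops I₀))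
  go (suc p) I₀ with suc p ≤? 2 ^ t ℕ.+ 4 | nonLoopList (deleteLoops I₀) (allFin m)
  ... | yes _ | _      = indicator (search (deleteLoops I₀))
  ... | no _  | []     = indicator ⊥
  ... | no _  | a ∷ as = average (λ e → go p (contract (deleteLoops I₀) e)) a as

_^ℚ_ : ℚ → ℕ → ℚ
q ^ℚ zero  = 1ℚ
q ^ℚ suc k = q * (q ^ℚ k)

expTerm : ℕ → ℕ → ℚ
expTerm x zero    = 1ℚ
expTerm x (suc i) = expTerm x i * (+ x / suc i)

expPartial : ℕ → ℕ → ℚ
expPartial x zero    = 1ℚ
expPartial x (suc j) = expPartial x j + expTerm x (suc j)

-- For q ≥ 0:  q ≤ e^{-x}  iff  q · e^x ≤ 1  iff  q · Σ_{i≤j} x^i/i! ≤ 1 for all j.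
_≤exp-_ : ℚ → ℕ → Set
q ≤exp- x = (j : ℕ) → q * expPartial x j Data.Rational.≤ 1ℚ

-- Let M = n − 2^t. In an instance whose minimum even cut has size k, two vertices of degree < k/2
-- with the same membership pattern in T_1,…,T_t would form the side {u,v} of an even cut of size
-- < k; so at most 2^t vertices have degree < k/2 and, by the handshake lemma, there are at least
-- k·M/4 non-loop edges. A uniformly random edge therefore misses a fixed minimum even cut C₀ with
-- probability ≥ 1 − 4/M, and contracting an edge outside C₀ keeps C₀ an even cut without creating
-- new ones. Once at most 2^t + 4 vertices are left, exhaustive search returns a cut of size k, so by
-- induction a run succeeds with probability p ≥ ∏_{i=5}^{M} (1 − 4/i) = 24/(M(M−1)(M−2)(M−3)) ≥ 24/n^4.
-- Finally (1 − p)^N ≤ e^(−Np) for N = c·n^4, which is proved against the partial sums of the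
-- exponential series from (1 − y)·e^(x+y) ≤ e^x.

module Submission where

open import Defs
open import Data.Bool using (Bool; true; false; _∧_; _∨_; _xor_; not; if_then_else_; T)
import Data.Bool.Properties as 𝔹ₚ
open import Data.Empty using (⊥-elim)
open import Data.Fin using (Fin; zero; suc; punchIn)
open import Data.Fin.Properties using (_≟_; suc-injective; punchOut-cong; punchOut-punchIn; punchIn-punchOut; punchInᵢ≢i)
open import Data.Fin.Subset using (Subset; ∣_∣; ⁅_⁆; _∩_; _∪_; ⊤; ⊥)
open import Data.Fin.Subset.Properties using (Empty-unique)
open import Data.List as List using (List; []; _∷_; length; allFin)
open import Data.List.Relation.Unary.All as All using (All; []; _∷_)
open import Data.Nat as ℕ using (ℕ; zero; suc; z≤n; s≤s)
import Data.Nat.Properties as ℕₚ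
open import Data.Product using (Σ; _×_; _,_; proj₁; proj₂)
open import Data.Vec using ([]; _∷_; lookup; tabulate)
open import Data.Vec.Properties using (lookup∘tabulate; tabulate-cong; lookup-zipWith; lookup-replicate; []=⇒lookup; lookup⇒[]=)
open import Function using (case_of_)
open import Relation.Binary.PropositionalEquality
open import Relation.Nullary using (Dec; yes; no; does; ¬_)
open import Algebra.Properties.Semiring.Sum ℕₚ.+-*-semiring
  using (sum; sum-cong-≗; ∑-distrib-+; ∑-comm; *-distribˡ-sum; sum-replicate-zero)

module Counting where

  open import Data.Nat using (_+_; _*_; _≤_)
  open import Data.Nat.Divisibility using (_∣_; divides)

  𝟙 : Bool → ℕ
  𝟙 true  = 1
  𝟙 false = 0

  sum-mono-≤ : ∀ {n} {f g : Fin n → ℕ} → (∀ i → f i ≤ g i) → sum f ≤ sum g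
  sum-mono-≤ {zero}  f≤g = z≤n
  sum-mono-≤ {suc n} f≤g = ℕₚ.+-mono-≤ (f≤g zero) (sum-mono-≤ (λ i → f≤g (suc i)))

  sum-if-≟ : ∀ {n} (g : Fin n → ℕ) (u : Fin n) → sum (λ w → if does (u ≟ w) then g w else 0) ≡ g u
  sum-if-≟ {suc n} g zero    = trans (cong (g zero +_) (sum-replicate-zero n)) (ℕₚ.+-identityʳ (g zero))
  sum-if-≟ {suc n} g (suc u) = sum-if-≟ (λ i → g (suc i)) u

  ∣p∣≡sum𝟙 : ∀ {n} (p : Subset n) → ∣ p ∣ ≡ sum (λ i → 𝟙 (lookup p i))
  ∣p∣≡sum𝟙 []          = refl
  ∣p∣≡sum𝟙 (true ∷ p)  = cong suc (∣p∣≡sum𝟙 p)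
  ∣p∣≡sum𝟙 (false ∷ p) = ∣p∣≡sum𝟙 p

  ∣tabulate∣≡sum𝟙 : ∀ {n} (f : Fin n → Bool) → ∣ tabulate f ∣ ≡ sum (λ i → 𝟙 (f i))
  ∣tabulate∣≡sum𝟙 f = trans (∣p∣≡sum𝟙 (tabulate f)) (sum-cong-≗ (λ i → cong 𝟙 (lookup∘tabulate f i)))

  lookup-⁅⁆ : ∀ {n} (v x : Fin n) → lookup ⁅ v ⁆ x ≡ does (v ≟ x)
  lookup-⁅⁆ zero    zero    = refl
  lookup-⁅⁆ zero    (suc x) = lookup-replicate x false
  lookup-⁅⁆ (suc v) zero    = refl
  lookup-⁅⁆ (suc v) (suc x) = lookup-⁅⁆ v x

  sum≡0⇒≡0 : ∀ {n} (f : Fin n → ℕ) → sum f ≡ 0 → ∀ i → f i ≡ 0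
  sum≡0⇒≡0 f h zero    = ℕₚ.m+n≡0⇒m≡0 (f zero) h
  sum≡0⇒≡0 f h (suc i) = sum≡0⇒≡0 (λ j → f (suc j)) (ℕₚ.m+n≡0⇒n≡0 (f zero) h) i

  does-≟-sym : ∀ {n} (a b : Fin n) → does (a ≟ b) ≡ does (b ≟ a)
  does-≟-sym a b with a ≟ b | b ≟ a
  ... | yes _   | yes _   = refl
  ... | no _    | no _    = refl
  ... | yes a≡b | no b≢a  = ⊥-elim (b≢a (sym a≡b))
  ... | no a≢b  | yes b≡a = ⊥-elim (a≢b (sym b≡a))

  does-≟-refl : ∀ {n} (u : Fin n) → does (u ≟ u) ≡ true
  does-≟-refl u with u ≟ u
  ... | yes _  = refl
  ... | no u≢u = ⊥-elim (u≢u refl)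

  does-≟-≢ : ∀ {n} {u w : Fin n} → w ≢ u → does (u ≟ w) ≡ false
  does-≟-≢ {u = u} {w} w≢u with u ≟ w
  ... | yes u≡w = ⊥-elim (w≢u (sym u≡w))
  ... | no _    = refl

  -- Parities as Booleans (true = odd), the encoding used by preimageParity.
  oddᵇ : ℕ → Bool
  oddᵇ zero    = false
  oddᵇ (suc n) = not (oddᵇ n)

  oddᵇ-homo-+ : ∀ a b → oddᵇ (a + b) ≡ oddᵇ a xor oddᵇ b
  oddᵇ-homo-+ zero    b = refl
  oddᵇ-homo-+ (suc a) b rewrite oddᵇ-homo-+ a b with oddᵇ a | oddᵇ b
  ... | true  | true  = refl
  ... | true  | false = refl
  ... | false | _     = refl

  oddᵇ-𝟙 : ∀ b → oddᵇ (𝟙 b) ≡ b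
  oddᵇ-𝟙 true  = refl
  oddᵇ-𝟙 false = refl

  2∣⇒oddᵇ≡false : ∀ n → 2 ∣ n → oddᵇ n ≡ false
  2∣⇒oddᵇ≡false n (divides q refl) = oddᵇ[q*2] q
    where
    oddᵇ[q*2] : ∀ q → oddᵇ (q * 2) ≡ false
    oddᵇ[q*2] zero    = refl
    oddᵇ[q*2] (suc q) = trans (𝔹ₚ.not-involutive (oddᵇ (q * 2))) (oddᵇ[q*2] q)

  oddᵇ≡false⇒2∣ : ∀ n → oddᵇ n ≡ false → 2 ∣ n
  oddᵇ≡false⇒2∣ zero          _ = divides 0 refl
  oddᵇ≡false⇒2∣ (suc (suc n)) h with oddᵇ≡false⇒2∣ n (trans (sym (𝔹ₚ.not-involutive (oddᵇ n))) h)
  ... | divides q eq = divides (suc q) (cong (λ z → suc (suc z)) eq)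

  2∣-respects-oddᵇ : ∀ {a b} → oddᵇ a ≡ oddᵇ b → 2 ∣ a → 2 ∣ b
  2∣-respects-oddᵇ {a} {b} eq 2∣a = oddᵇ≡false⇒2∣ b (trans (sym eq) (2∣⇒oddᵇ≡false a 2∣a))

  sum-oddᵇ-cong : ∀ {n} {f g : Fin n → ℕ} → (∀ i → oddᵇ (f i) ≡ oddᵇ (g i)) → oddᵇ (sum f) ≡ oddᵇ (sum g)
  sum-oddᵇ-cong {zero}          eq = refl
  sum-oddᵇ-cong {suc n} {f} {g} eq = begin
    oddᵇ (f zero + sum (λ i → f (suc i)))              ≡⟨ oddᵇ-homo-+ (f zero) _ ⟩
    oddᵇ (f zero) xor oddᵇ (sum (λ i → f (suc i)))     ≡⟨ cong₂ _xor_ (eq zero) (sum-oddᵇ-cong (λ i → eq (suc i))) ⟩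
    oddᵇ (g zero) xor oddᵇ (sum (λ i → g (suc i)))     ≡⟨ oddᵇ-homo-+ (g zero) _ ⟨
    oddᵇ (g zero + sum (λ i → g (suc i)))              ∎
    where open ≡-Reasoning

module Degrees where

  open import Data.Nat using (_+_; _*_; _≤_)

  open Counting

  isNonLoop : ∀ {m t n'} → Inst m t n' → Fin m → Bool
  isNonLoop I e = lookup (edges I) e ∧ not (does (proj₁ (ends I e) ≟ proj₂ (ends I e)))

  nonLoops : ∀ {m t n'} → Inst m t n' → ℕ
  nonLoops I = sum (λ e → 𝟙 (isNonLoop I e))

  deg : ∀ {m t n'} → Inst m t n' → Fin n' → ℕ
  deg I v = ∣ δ I ⁅ v ⁆ ∣

  δ-deleteLoops : ∀ {m t n'} (I : Inst m t n') X → δ (deleteLoops I) X ≡ δ I X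
  δ-deleteLoops I X = tabulate-cong same
    where
    same : ∀ e → lookup (edges (deleteLoops I)) e ∧ crosses (ends I) X e ≡ lookup (edges I) e ∧ crosses (ends I) X e
    same e rewrite lookup∘tabulate (isNonLoop I) e with proj₁ (ends I e) ≟ proj₂ (ends I e)
    ... | yes x≡y rewrite x≡y | 𝔹ₚ.xor-same (lookup X (proj₂ (ends I e))) | 𝔹ₚ.∧-zeroʳ (lookup (edges I) e) = refl
    ... | no _    rewrite 𝔹ₚ.∧-identityʳ (lookup (edges I) e) = refl

  crossing⇒isNonLoop : ∀ {m t n'} (I : Inst m t n') X e → lookup (δ I X) e ≡ true → isNonLoop I e ≡ true
  crossing⇒isNonLoop I X e e∈δ
    rewrite lookup∘tabulate (λ f → lookup (edges I) f ∧ crosses (ends I) X f) e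
    with lookup (edges I) e | proj₁ (ends I e) ≟ proj₂ (ends I e)
  ... | true | no _    = refl
  ... | true | yes x≡y rewrite x≡y | 𝔹ₚ.xor-same (lookup X (proj₂ (ends I e))) = e∈δ

  nonLoops≡0⇒δ≡⊥ : ∀ {m t n'} (I : Inst m t n') X → nonLoops I ≡ 0 → δ I X ≡ ⊥
  nonLoops≡0⇒δ≡⊥ I X none = Empty-unique λ (e , e∈δ) →
    case trans (sym (cong 𝟙 (crossing⇒isNonLoop I X e ([]=⇒lookup e∈δ)))) (sum≡0⇒≡0 _ none e) of λ ()

  sumₗ : ∀ {A : Set} → (A → ℕ) → List A → ℕ
  sumₗ f []       = 0
  sumₗ f (a ∷ as) = f a + sumₗ f as

  sumₗ-tabulate : ∀ {A : Set} {n} (f : A → ℕ) (g : Fin n → A) → sumₗ f (List.tabulate g) ≡ sum (λ i → f (g i))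
  sumₗ-tabulate {n = zero}  f g = refl
  sumₗ-tabulate {n = suc n} f g = cong (f (g zero) +_) (sumₗ-tabulate f (λ i → g (suc i)))

  sumₗ-allFin : ∀ {n} (f : Fin n → ℕ) → sumₗ f (allFin n) ≡ sum f
  sumₗ-allFin f = sumₗ-tabulate f (λ i → i)

  countIn : ∀ {m} {E : Fin m → Set} → Subset m → List (Σ (Fin m) E) → ℕ
  countIn C = sumₗ (λ b → 𝟙 (lookup C (proj₁ b)))

  length-nonLoopList : ∀ {m t n'} (I : Inst m t n') es → length (nonLoopList I es) ≡ sumₗ (λ e → 𝟙 (isNonLoop I e)) es
  length-nonLoopList I [] = refl
  length-nonLoopList I (e ∷ es) with lookup (edges I) e | proj₁ (ends I e) ≟ proj₂ (ends I e)
  ... | true  | no _  = cong suc (length-nonLoopList I es)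
  ... | true  | yes _ = length-nonLoopList I es
  ... | false | _     = length-nonLoopList I es

  length-nonLoopList-allFin : ∀ {m t n'} (I : Inst m t n') → length (nonLoopList I (allFin m)) ≡ nonLoops I
  length-nonLoopList-allFin {m} I = trans (length-nonLoopList I (allFin m)) (sumₗ-allFin (λ e → 𝟙 (isNonLoop I e)))

  nonLoopList-present : ∀ {m t n'} (I : Inst m t n') es → All (λ b → lookup (edges I) (proj₁ b) ≡ true) (nonLoopList I es)
  nonLoopList-present I [] = []
  nonLoopList-present I (e ∷ es) with lookup (edges I) e in e∈E | proj₁ (ends I e) ≟ proj₂ (ends I e)
  ... | true  | no _  = e∈E ∷ nonLoopList-present I es
  ... | true  | yes _ = nonLoopList-present I es
  ... | false | _     = nonLoopList-present I es

  countIn-nonLoopList : ∀ {m t n'} (I : Inst m t n') (C : Subset m) es →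
                        countIn C (nonLoopList I es) ≤ sumₗ (λ e → 𝟙 (lookup C e)) es
  countIn-nonLoopList I C [] = z≤n
  countIn-nonLoopList I C (e ∷ es) with lookup (edges I) e | proj₁ (ends I e) ≟ proj₂ (ends I e)
  ... | true  | no _  = ℕₚ.+-monoʳ-≤ (𝟙 (lookup C e)) (countIn-nonLoopList I C es)
  ... | true  | yes _ = ℕₚ.≤-trans (countIn-nonLoopList I C es) (ℕₚ.m≤n+m _ _)
  ... | false | _     = ℕₚ.≤-trans (countIn-nonLoopList I C es) (ℕₚ.m≤n+m _ _)

  countIn-nonLoopList-allFin : ∀ {m t n'} (I : Inst m t n') (C : Subset m) → countIn C (nonLoopList I (allFin m)) ≤ ∣ C ∣
  countIn-nonLoopList-allFin {m} I C = ℕₚ.≤-trans (countIn-nonLoopList I C (allFin m))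
    (ℕₚ.≤-reflexive (trans (sumₗ-allFin (λ e → 𝟙 (lookup C e))) (sym (∣p∣≡sum𝟙 C))))

  incidences : ∀ {n} b (x y : Fin n) → sum (λ v → 𝟙 (b ∧ (does (v ≟ x) xor does (v ≟ y)))) ≡ 2 * 𝟙 (b ∧ not (does (x ≟ y)))
  incidences {n} false x y = sum-replicate-zero n
  incidences {n} true  x y with x ≟ y
  ... | yes refl = trans (sum-cong-≗ (λ v → cong 𝟙 (𝔹ₚ.xor-same (does (v ≟ x))))) (sum-replicate-zero n)
  ... | no x≢y = begin
      sum (λ v → 𝟙 (does (v ≟ x) xor does (v ≟ y)))
    ≡⟨ sum-cong-≗ split ⟩
      sum (λ v → 𝟙≟ v x + 𝟙≟ v y)
    ≡⟨ ∑-distrib-+ (λ v → 𝟙≟ v x) (λ v → 𝟙≟ v y) ⟩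
      sum (λ v → 𝟙≟ v x) + sum (λ v → 𝟙≟ v y)
    ≡⟨ cong₂ _+_ (hits x) (hits y) ⟩
      2 ∎
    where
    open ≡-Reasoning
    𝟙≟ : Fin n → Fin n → ℕ
    𝟙≟ v u = if does (v ≟ u) then 1 else 0
    hits : ∀ u → sum (λ v → 𝟙≟ v u) ≡ 1
    hits u = trans (sum-cong-≗ (λ v → cong (λ b → if b then 1 else 0) (does-≟-sym v u))) (sum-if-≟ (λ _ → 1) u)
    split : ∀ v → 𝟙 (does (v ≟ x) xor does (v ≟ y)) ≡ 𝟙≟ v x + 𝟙≟ v y
    split v with v ≟ x | v ≟ y
    ... | yes v≡x | yes v≡y = ⊥-elim (x≢y (trans (sym v≡x) v≡y))
    ... | yes _   | no _    = refl
    ... | no _    | yes _   = refl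
    ... | no _    | no _    = refl

  deg≡sum-incidences : ∀ {m t n'} (I : Inst m t n') v →
    deg I v ≡ sum (λ e → 𝟙 (lookup (edges I) e ∧ (does (v ≟ proj₁ (ends I e)) xor does (v ≟ proj₂ (ends I e)))))
  deg≡sum-incidences {m} I v = trans (∣tabulate∣≡sum𝟙 {m} _) (sum-cong-≗ λ e → cong (λ z → 𝟙 (lookup (edges I) e ∧ z))
    (cong₂ _xor_ (lookup-⁅⁆ v (proj₁ (ends I e))) (lookup-⁅⁆ v (proj₂ (ends I e)))))

  handshake : ∀ {m t n'} (I : Inst m t n') → sum (deg I) ≡ 2 * nonLoops I
  handshake {m} {t} {n'} I = begin
      sum (deg I)
    ≡⟨ sum-cong-≗ (deg≡sum-incidences I) ⟩
      sum (λ v → sum (λ e → 𝟙 (lookup (edges I) e ∧ (does (v ≟ x e) xor does (v ≟ y e)))))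
    ≡⟨ ∑-comm {n'} {m} _ ⟩
      sum (λ e → sum (λ v → 𝟙 (lookup (edges I) e ∧ (does (v ≟ x e) xor does (v ≟ y e)))))
    ≡⟨ sum-cong-≗ (λ e → incidences (lookup (edges I) e) (x e) (y e)) ⟩
      sum (λ e → 2 * 𝟙 (isNonLoop I e))
    ≡⟨ *-distribˡ-sum 2 (λ e → 𝟙 (isNonLoop I e)) ⟨
      2 * nonLoops I ∎
    where
    open ≡-Reasoning
    x y : Fin m → Fin n'
    x e = proj₁ (ends I e)
    y e = proj₂ (ends I e)

module LowDegreeVertices where

  open import Data.Nat using (_+_; _*_; _≤_; _<_; _^_; _∸_; _<ᵇ_)
  open import Data.Nat.Divisibility using (divides)
  open import Data.Nat.Solver using (module +-*-Solver)

  open Counting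
  open Degrees

  ⁅u⁆∪⁅v⁆-evenSide : ∀ {m t n'} (I : Inst m t n') {u v w : Fin n'} → u ≢ v → w ≢ u → w ≢ v →
    (∀ i → lookup (Ts I i) u ≡ lookup (Ts I i) v) → EvenSide I (⁅ u ⁆ ∪ ⁅ v ⁆)
  ⁅u⁆∪⁅v⁆-evenSide {n' = n'} I {u} {v} {w} u≢v w≢u w≢v samePattern =
    (u , lookup⇒[]= u X (trans (lookup-X u) (cong (_∨ does (v ≟ u)) (does-≟-refl u)))) ,
    (w , λ w∈X → case trans (sym ([]=⇒lookup w∈X)) (trans (lookup-X w) (cong₂ _∨_ (does-≟-≢ w≢u) (does-≟-≢ w≢v))) of λ ()) ,
    λ i → divides (𝟙 (lookup (Ts I i) u)) (∣T∩X∣ (Ts I i) (samePattern i))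
    where
    X = ⁅ u ⁆ ∪ ⁅ v ⁆
    lookup-X : ∀ z → lookup X z ≡ does (u ≟ z) ∨ does (v ≟ z)
    lookup-X z = trans (lookup-zipWith _∨_ z ⁅ u ⁆ ⁅ v ⁆) (cong₂ _∨_ (lookup-⁅⁆ u z) (lookup-⁅⁆ v z))
    [_]_if_ : Subset n' → Fin n' → Fin n' → ℕ
    [ T ] z if a = if does (a ≟ z) then 𝟙 (lookup T z) else 0
    ∣T∩X∣ : ∀ T → lookup T u ≡ lookup T v → ∣ T ∩ X ∣ ≡ 𝟙 (lookup T u) * 2
    ∣T∩X∣ T Tu≡Tv = begin
        ∣ T ∩ X ∣
      ≡⟨ ∣p∣≡sum𝟙 (T ∩ X) ⟩
        sum (λ z → 𝟙 (lookup (T ∩ X) z))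
      ≡⟨ sum-cong-≗ split ⟩
        sum (λ z → [ T ] z if u + [ T ] z if v)
      ≡⟨ ∑-distrib-+ (λ z → [ T ] z if u) (λ z → [ T ] z if v) ⟩
        sum (λ z → [ T ] z if u) + sum (λ z → [ T ] z if v)
      ≡⟨ cong₂ _+_ (sum-if-≟ (λ z → 𝟙 (lookup T z)) u) (sum-if-≟ (λ z → 𝟙 (lookup T z)) v) ⟩
        𝟙 (lookup T u) + 𝟙 (lookup T v)
      ≡⟨ cong (λ b → 𝟙 (lookup T u) + 𝟙 b) Tu≡Tv ⟨
        𝟙 (lookup T u) + 𝟙 (lookup T u)
      ≡⟨ solve 1 (λ a → a :+ a := a :* con 2) refl (𝟙 (lookup T u)) ⟩
        𝟙 (lookup T u) * 2 ∎
      where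
      open ≡-Reasoning
      open +-*-Solver
      split : ∀ z → 𝟙 (lookup (T ∩ X) z) ≡ [ T ] z if u + [ T ] z if v
      split z rewrite lookup-zipWith _∧_ z T X | lookup-X z with u ≟ z | v ≟ z
      ... | yes u≡z | yes v≡z = ⊥-elim (u≢v (trans u≡z (sym v≡z)))
      ... | yes _   | no _    = trans (cong 𝟙 (𝔹ₚ.∧-identityʳ (lookup T z))) (sym (ℕₚ.+-identityʳ _))
      ... | no _    | yes _   = cong 𝟙 (𝔹ₚ.∧-identityʳ (lookup T z))
      ... | no _    | no _    = cong 𝟙 (𝔹ₚ.∧-zeroʳ (lookup T z))

  private
    𝟙-∧-xor-∨-≤ : ∀ E a b c d → 𝟙 (E ∧ ((a ∨ b) xor (c ∨ d))) ≤ 𝟙 (E ∧ (a xor c)) + 𝟙 (E ∧ (b xor d))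
    𝟙-∧-xor-∨-≤ false a     b     c     d     = z≤n
    𝟙-∧-xor-∨-≤ true  true  b     true  d     = z≤n
    𝟙-∧-xor-∨-≤ true  true  b     false true  = z≤n
    𝟙-∧-xor-∨-≤ true  true  b     false false = s≤s z≤n
    𝟙-∧-xor-∨-≤ true  false true  true  d     = z≤n
    𝟙-∧-xor-∨-≤ true  false true  false true  = z≤n
    𝟙-∧-xor-∨-≤ true  false true  false false = s≤s z≤n
    𝟙-∧-xor-∨-≤ true  false false true  d     = s≤s z≤n
    𝟙-∧-xor-∨-≤ true  false false false true  = s≤s z≤n
    𝟙-∧-xor-∨-≤ true  false false false false = z≤n

  ∣δ[⁅u⁆∪⁅v⁆]∣≤deg+deg : ∀ {m t n'} (I : Inst m t n') (u v : Fin n') → ∣ δ I (⁅ u ⁆ ∪ ⁅ v ⁆) ∣ ≤ deg I u + deg I v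
  ∣δ[⁅u⁆∪⁅v⁆]∣≤deg+deg {m} I u v = begin
      ∣ δ I (⁅ u ⁆ ∪ ⁅ v ⁆) ∣
    ≡⟨ ∣tabulate∣≡sum𝟙 {m} _ ⟩
      sum (λ e → 𝟙 (present e ∧ crosses (ends I) (⁅ u ⁆ ∪ ⁅ v ⁆) e))
    ≤⟨ sum-mono-≤ crosses-∪ ⟩
      sum (λ e → 𝟙 (present e ∧ crosses (ends I) ⁅ u ⁆ e) + 𝟙 (present e ∧ crosses (ends I) ⁅ v ⁆ e))
    ≡⟨ ∑-distrib-+ (λ e → 𝟙 (present e ∧ crosses (ends I) ⁅ u ⁆ e)) (λ e → 𝟙 (present e ∧ crosses (ends I) ⁅ v ⁆ e)) ⟩
      sum (λ e → 𝟙 (present e ∧ crosses (ends I) ⁅ u ⁆ e)) + sum (λ e → 𝟙 (present e ∧ crosses (ends I) ⁅ v ⁆ e))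
    ≡⟨ cong₂ _+_ (∣tabulate∣≡sum𝟙 {m} _) (∣tabulate∣≡sum𝟙 {m} _) ⟨
      deg I u + deg I v ∎
    where
    open ℕₚ.≤-Reasoning
    present = lookup (edges I)
    crosses-∪ : ∀ e → 𝟙 (present e ∧ crosses (ends I) (⁅ u ⁆ ∪ ⁅ v ⁆) e)
                      ≤ 𝟙 (present e ∧ crosses (ends I) ⁅ u ⁆ e) + 𝟙 (present e ∧ crosses (ends I) ⁅ v ⁆ e)
    crosses-∪ e
      rewrite lookup-zipWith _∨_ (proj₁ (ends I e)) ⁅ u ⁆ ⁅ v ⁆ | lookup-zipWith _∨_ (proj₂ (ends I e)) ⁅ u ⁆ ⁅ v ⁆
      = 𝟙-∧-xor-∨-≤ (present e) (lookup ⁅ u ⁆ (proj₁ (ends I e))) (lookup ⁅ v ⁆ (proj₁ (ends I e)))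
                                (lookup ⁅ u ⁆ (proj₂ (ends I e))) (lookup ⁅ v ⁆ (proj₂ (ends I e)))

  count≤1 : ∀ {n} (B : Fin n → Bool) → (∀ u v → B u ≡ true → B v ≡ true → u ≡ v) → sum (λ v → 𝟙 (B v)) ≤ 1
  count≤1 {zero}  B unique = z≤n
  count≤1 {suc n} B unique with B zero in B0
  ... | true  = ℕₚ.≤-reflexive (cong suc (trans (sum-cong-≗ rest) (sum-replicate-zero n)))
    where
    rest : ∀ i → 𝟙 (B (suc i)) ≡ 0
    rest i with B (suc i) in Bi
    ... | true  = case unique zero (suc i) B0 Bi of λ ()
    ... | false = refl
  ... | false = count≤1 (λ i → B (suc i)) (λ u v Bu Bv → suc-injective (unique (suc u) (suc v) Bu Bv))

  count≤2^ : ∀ t {n} (P : Fin n → Fin t → Bool) (B : Fin n → Bool) →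
    (∀ u v → B u ≡ true → B v ≡ true → (∀ i → P u i ≡ P v i) → u ≡ v) → sum (λ v → 𝟙 (B v)) ≤ 2 ^ t
  count≤2^ zero    P B injective = count≤1 B (λ u v Bu Bv → injective u v Bu Bv (λ ()))
  count≤2^ (suc t) {n} P B injective = begin
      sum (λ v → 𝟙 (B v))
    ≡⟨ sum-cong-≗ split ⟩
      sum (λ v → 𝟙 (B₁ v) + 𝟙 (B₀ v))
    ≡⟨ ∑-distrib-+ (λ v → 𝟙 (B₁ v)) (λ v → 𝟙 (B₀ v)) ⟩
      sum (λ v → 𝟙 (B₁ v)) + sum (λ v → 𝟙 (B₀ v))
    ≤⟨ ℕₚ.+-mono-≤ (count≤2^ t P′ B₁ injective₁) (count≤2^ t P′ B₀ injective₀) ⟩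
      2 ^ t + 2 ^ t
    ≡⟨ cong (2 ^ t +_) (ℕₚ.+-identityʳ (2 ^ t)) ⟨
      2 ^ suc t ∎
    where
    open ℕₚ.≤-Reasoning
    B₁ B₀ : Fin n → Bool
    B₁ v = B v ∧ P v zero
    B₀ v = B v ∧ not (P v zero)
    P′ : Fin n → Fin t → Bool
    P′ v i = P v (suc i)
    split : ∀ v → 𝟙 (B v) ≡ 𝟙 (B₁ v) + 𝟙 (B₀ v)
    split v with B v | P v zero
    ... | true  | true  = refl
    ... | true  | false = refl
    ... | false | _     = refl
    ∧-true : ∀ {a b} → a ∧ b ≡ true → a ≡ true × b ≡ true
    ∧-true {true} {true} _ = refl , refl
    not-true : ∀ {a} → not a ≡ true → a ≡ false
    not-true {false} _ = refl
    PatternInjective : (Fin n → Bool) → Set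
    PatternInjective B′ = ∀ u v → B′ u ≡ true → B′ v ≡ true → (∀ i → P′ u i ≡ P′ v i) → u ≡ v
    injective′ : ∀ (B′ : Fin n → Bool) → (∀ {u} → B′ u ≡ true → B u ≡ true) →
                 (∀ {u v} → B′ u ≡ true → B′ v ≡ true → P u zero ≡ P v zero) → PatternInjective B′
    injective′ B′ B′⊆B sameBit u v Bu Bv same = injective u v (B′⊆B Bu) (B′⊆B Bv)
      λ { zero → sameBit Bu Bv ; (suc i) → same i }
    injective₁ : PatternInjective B₁
    injective₁ = injective′ B₁ (λ Bu → proj₁ (∧-true Bu)) (λ Bu Bv → trans (proj₂ (∧-true Bu)) (sym (proj₂ (∧-true Bv))))
    injective₀ : PatternInjective B₀
    injective₀ = injective′ B₀ (λ Bu → proj₁ (∧-true Bu))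
                               (λ Bu Bv → trans (not-true (proj₂ (∧-true Bu))) (sym (not-true (proj₂ (∧-true Bv)))))

  third-vertex : ∀ {n'} → 3 ≤ n' → (u v : Fin n') → Σ (Fin n') λ w → w ≢ u × w ≢ v
  third-vertex {suc (suc (suc _))} (s≤s (s≤s (s≤s _))) u v with zero ≟ u | zero ≟ v
  ... | no 0≢u   | no 0≢v = zero , 0≢u , 0≢v
  ... | yes refl | _ with suc zero ≟ v
  ...   | no 1≢v   = suc zero , (λ ()) , 1≢v
  ...   | yes refl = suc (suc zero) , (λ ()) , (λ ())
  third-vertex {suc (suc (suc _))} (s≤s (s≤s (s≤s _))) u v | no 0≢u | yes refl with suc zero ≟ u
  ...   | no 1≢u   = suc zero , 1≢u , (λ ())
  ...   | yes refl = suc (suc zero) , (λ ()) , (λ ())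

  sum-1 : ∀ n → sum {n} (λ _ → 1) ≡ n
  sum-1 zero    = refl
  sum-1 (suc n) = cong suc (sum-1 n)

  module _ {m t n'} (I : Inst m t n') (k : ℕ) (k≤cuts : ∀ D → IsEvenCut I D → k ≤ ∣ D ∣) (n'≥3 : 3 ≤ n') where

    lowDegree : Fin n' → Bool
    lowDegree v = 2 * deg I v <ᵇ k

    -- Two low-degree vertices with the same T-pattern would form the side of an even cut of size < k.
    lowDegree-patterns-distinct : ∀ u v → lowDegree u ≡ true → lowDegree v ≡ true →
                                  (∀ i → lookup (Ts I i) u ≡ lookup (Ts I i) v) → u ≡ v
    lowDegree-patterns-distinct u v low-u low-v samePattern with u ≟ v
    ... | yes u≡v = u≡v
    ... | no  u≢v = ⊥-elim (ℕₚ.<-irrefl refl (ℕₚ.<-≤-trans (ℕₚ.+-mono-< (low⇒ {u} low-u) (low⇒ {v} low-v)) 2k≤))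
      where
      open +-*-Solver
      low⇒ : ∀ {x} → lowDegree x ≡ true → 2 * deg I x < k
      low⇒ {x} h = ℕₚ.<ᵇ⇒< (2 * deg I x) k (subst T (sym h) _)
      w = third-vertex n'≥3 u v
      k≤ : k ≤ deg I u + deg I v
      k≤ = ℕₚ.≤-trans (k≤cuts _ (_ , ⁅u⁆∪⁅v⁆-evenSide I u≢v (proj₁ (proj₂ w)) (proj₂ (proj₂ w)) samePattern , refl))
                      (∣δ[⁅u⁆∪⁅v⁆]∣≤deg+deg I u v)
      2k≤ : k + k ≤ 2 * deg I u + 2 * deg I v
      2k≤ = ℕₚ.≤-trans (ℕₚ.+-mono-≤ k≤ k≤)
        (ℕₚ.≤-reflexive (solve 2 (λ a b → (a :+ b) :+ (a :+ b) := con 2 :* a :+ con 2 :* b) refl (deg I u) (deg I v)))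

    n∸2^t≤#highDegree : n' ∸ 2 ^ t ≤ sum (λ v → 𝟙 (not (lowDegree v)))
    n∸2^t≤#highDegree = begin
        n' ∸ 2 ^ t
      ≤⟨ ℕₚ.∸-monoʳ-≤ n' (count≤2^ t (λ v i → lookup (Ts I i) v) lowDegree lowDegree-patterns-distinct) ⟩
        n' ∸ #low
      ≡⟨ cong (_∸ #low) (sym #high+#low≡n') ⟩
        #high + #low ∸ #low
      ≡⟨ ℕₚ.m+n∸n≡m #high #low ⟩
        #high ∎
      where
      open ℕₚ.≤-Reasoning
      #low #high : ℕ
      #low  = sum (λ v → 𝟙 (lowDegree v))
      #high = sum (λ v → 𝟙 (not (lowDegree v)))
      #high+#low≡n' : #high + #low ≡ n'
      #high+#low≡n' = trans (sym (∑-distrib-+ (λ v → 𝟙 (not (lowDegree v))) (λ v → 𝟙 (lowDegree v))))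
        (trans (sum-cong-≗ (λ v → 𝟙not+𝟙≡1 (lowDegree v))) (sum-1 n'))
        where
        𝟙not+𝟙≡1 : ∀ b → 𝟙 (not b) + 𝟙 b ≡ 1
        𝟙not+𝟙≡1 true  = refl
        𝟙not+𝟙≡1 false = refl

    -- Every vertex outside the at most 2^t low-degree ones has degree ≥ k/2; count edge ends.
    k*[n∸2^t]≤4*nonLoops : k * (n' ∸ 2 ^ t) ≤ 4 * nonLoops I
    k*[n∸2^t]≤4*nonLoops = begin
        k * (n' ∸ 2 ^ t)
      ≤⟨ ℕₚ.*-monoʳ-≤ k n∸2^t≤#highDegree ⟩
        k * sum (λ v → 𝟙 (not (lowDegree v)))
      ≡⟨ *-distribˡ-sum k (λ v → 𝟙 (not (lowDegree v))) ⟩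
        sum (λ v → k * 𝟙 (not (lowDegree v)))
      ≤⟨ sum-mono-≤ high⇒ ⟩
        sum (λ v → 2 * deg I v)
      ≡⟨ *-distribˡ-sum 2 (deg I) ⟨
        2 * sum (deg I)
      ≡⟨ cong (2 *_) (handshake I) ⟩
        2 * (2 * nonLoops I)
      ≡⟨ ℕₚ.*-assoc 2 2 (nonLoops I) ⟨
        4 * nonLoops I ∎
      where
      open ℕₚ.≤-Reasoning
      high⇒ : ∀ v → k * 𝟙 (not (lowDegree v)) ≤ 2 * deg I v
      high⇒ v with 2 * deg I v <ᵇ k in low
      ... | true  = ℕₚ.≤-trans (ℕₚ.≤-reflexive (ℕₚ.*-zeroʳ k)) z≤n
      ... | false = ℕₚ.≤-trans (ℕₚ.≤-reflexive (ℕₚ.*-identityʳ k)) (ℕₚ.≮⇒≥ λ lt → subst T low (ℕₚ.<⇒<ᵇ lt))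

module Contraction where


  open Counting

  private
    foldr-xor≡oddᵇ-sum : ∀ {A : Set} {n} (g : A → Bool) (h : Fin n → A) →
      List.foldr (λ v r → g v xor r) false (List.tabulate h) ≡ oddᵇ (sum (λ i → 𝟙 (g (h i))))
    foldr-xor≡oddᵇ-sum {n = zero}  g h = refl
    foldr-xor≡oddᵇ-sum {n = suc n} g h =
      trans (cong₂ _xor_ (sym (oddᵇ-𝟙 (g (h zero)))) (foldr-xor≡oddᵇ-sum g (λ i → h (suc i))))
            (sym (oddᵇ-homo-+ (𝟙 (g (h zero))) _))

    if-sum : ∀ {n} (x : Bool) (g : Fin n → ℕ) → (if x then sum g else 0) ≡ sum (λ v → if x then g v else 0)
    if-sum true      g = refl
    if-sum {n} false g = sym (sum-replicate-zero n)

    if-𝟙-∧-swap : ∀ x t d → (if x then 𝟙 (t ∧ d) else 0) ≡ (if d then 𝟙 (t ∧ x) else 0)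
    if-𝟙-∧-swap true  true  true  = refl
    if-𝟙-∧-swap true  true  false = refl
    if-𝟙-∧-swap true  false true  = refl
    if-𝟙-∧-swap true  false false = refl
    if-𝟙-∧-swap false true  true  = refl
    if-𝟙-∧-swap false true  false = refl
    if-𝟙-∧-swap false false true  = refl
    if-𝟙-∧-swap false false false = refl

  preimageParity≡oddᵇ : ∀ {a b} (f : Fin a → Fin b) (T : Subset a) w →
    preimageParity f T w ≡ oddᵇ (sum (λ v → 𝟙 (lookup T v ∧ does (f v ≟ w))))
  preimageParity≡oddᵇ f T w = foldr-xor≡oddᵇ-sum (λ v → lookup T v ∧ does (f v ≟ w)) (λ i → i)

  oddᵇ∣T′∩X′∣≡oddᵇ∣T∩Y∣ : ∀ {a b} (f : Fin a → Fin b) (T : Subset a) (X′ : Subset b) (Y : Subset a) →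
    (∀ v → lookup Y v ≡ lookup X′ (f v)) → oddᵇ ∣ tabulate (preimageParity f T) ∩ X′ ∣ ≡ oddᵇ ∣ T ∩ Y ∣
  oddᵇ∣T′∩X′∣≡oddᵇ∣T∩Y∣ {a} {b} f T X′ Y Y≡f⁻¹X′ = begin
      oddᵇ ∣ T′ ∩ X′ ∣
    ≡⟨ cong oddᵇ (∣p∣≡sum𝟙 (T′ ∩ X′)) ⟩
      oddᵇ (sum (λ w → 𝟙 (lookup (T′ ∩ X′) w)))
    ≡⟨ sum-oddᵇ-cong pointwise ⟩
      oddᵇ (sum (λ w → if lookup X′ w then sum (λ v → hit v w) else 0))
    ≡⟨ cong oddᵇ (sum-cong-≗ (λ w → if-sum (lookup X′ w) (λ v → hit v w))) ⟩
      oddᵇ (sum (λ w → sum (λ v → if lookup X′ w then hit v w else 0)))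
    ≡⟨ cong oddᵇ (∑-comm {b} {a} (λ w v → if lookup X′ w then hit v w else 0)) ⟩
      oddᵇ (sum (λ v → sum (λ w → if lookup X′ w then hit v w else 0)))
    ≡⟨ cong oddᵇ (sum-cong-≗ (λ v → trans (sum-cong-≗ (λ w → if-𝟙-∧-swap (lookup X′ w) (lookup T v) (does (f v ≟ w))))
                                           (sum-if-≟ (λ w → 𝟙 (lookup T v ∧ lookup X′ w)) (f v)))) ⟩
      oddᵇ (sum (λ v → 𝟙 (lookup T v ∧ lookup X′ (f v))))
    ≡⟨ cong oddᵇ (sum-cong-≗ (λ v → cong 𝟙 (trans (cong (lookup T v ∧_) (sym (Y≡f⁻¹X′ v)))
                                                   (sym (lookup-zipWith _∧_ v T Y))))) ⟩
      oddᵇ (sum (λ v → 𝟙 (lookup (T ∩ Y) v)))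
    ≡⟨ cong oddᵇ (∣p∣≡sum𝟙 (T ∩ Y)) ⟨
      oddᵇ ∣ T ∩ Y ∣ ∎
    where
    open ≡-Reasoning
    T′ = tabulate (preimageParity f T)
    hit : Fin a → Fin b → ℕ
    hit v w = 𝟙 (lookup T v ∧ does (f v ≟ w))
    pointwise : ∀ w → oddᵇ (𝟙 (lookup (T′ ∩ X′) w)) ≡ oddᵇ (if lookup X′ w then sum (λ v → hit v w) else 0)
    pointwise w rewrite lookup-zipWith _∧_ w T′ X′ | lookup∘tabulate (preimageParity f T) w | preimageParity≡oddᵇ f T w
      with lookup X′ w
    ... | true  = trans (cong (λ z → oddᵇ (𝟙 z)) (𝔹ₚ.∧-identityʳ (oddᵇ (sum (λ v → hit v w))))) (oddᵇ-𝟙 _)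
    ... | false = cong (λ z → oddᵇ (𝟙 z)) (𝔹ₚ.∧-zeroʳ (oddᵇ (sum (λ v → hit v w))))

  module _ {p : ℕ} {x y : Fin (suc p)} (x≢y : x ≢ y) where

    merge∘punchIn : ∀ w → merge x≢y (punchIn y w) ≡ w
    merge∘punchIn w with punchIn y w ≟ y
    ... | yes eq = ⊥-elim (punchInᵢ≢i y w eq)
    ... | no _   = trans (punchOut-cong y refl) (punchOut-punchIn y)

    lookup-punchIn∘merge : ∀ (Y : Subset (suc p)) → lookup Y x ≡ lookup Y y →
                           ∀ v → lookup Y (punchIn y (merge x≢y v)) ≡ lookup Y v
    lookup-punchIn∘merge Y Yx≡Yy v with v ≟ y
    ... | yes v≡y = trans (cong (lookup Y) (punchIn-punchOut _)) (trans Yx≡Yy (cong (lookup Y) (sym v≡y)))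
    ... | no _    = cong (lookup Y) (punchIn-punchOut _)

  module _ {m t p} (I : Inst m t (suc p)) (e : Fin m) (x≢y : proj₁ (ends I e) ≢ proj₂ (ends I e))
           (X′ : Subset p) (Y : Subset (suc p)) (Y≡merge⁻¹X′ : ∀ v → lookup Y v ≡ lookup X′ (merge x≢y v)) where

    private
      I′ = contract I (e , x≢y)
      y = proj₂ (ends I e)

    δ-contract : δ I′ X′ ≡ δ I Y
    δ-contract = tabulate-cong λ f → cong (lookup (edges I) f ∧_)
      (cong₂ _xor_ (sym (Y≡merge⁻¹X′ (proj₁ (ends I f)))) (sym (Y≡merge⁻¹X′ (proj₂ (ends I f)))))

    evenSide-contract⇒evenSide : EvenSide I′ X′ → EvenSide I Y
    evenSide-contract⇒evenSide ((w , w∈X′) , (w′ , w′∉X′) , even) =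
      (punchIn y w , lookup⇒[]= _ Y (trans (Y≡merge⁻¹X′ _) (trans (cong (lookup X′) (merge∘punchIn x≢y w)) ([]=⇒lookup w∈X′)))) ,
      (punchIn y w′ , λ h → w′∉X′ (lookup⇒[]= _ X′
        (trans (cong (lookup X′) (sym (merge∘punchIn x≢y w′))) (trans (sym (Y≡merge⁻¹X′ _)) ([]=⇒lookup h))))) ,
      λ i → 2∣-respects-oddᵇ (oddᵇ∣T′∩X′∣≡oddᵇ∣T∩Y∣ (merge x≢y) (Ts I i) X′ Y Y≡merge⁻¹X′) (even i)

    evenSide⇒evenSide-contract : EvenSide I Y → EvenSide I′ X′
    evenSide⇒evenSide-contract ((v , v∈Y) , (v′ , v′∉Y) , even) =
      (merge x≢y v , lookup⇒[]= _ X′ (trans (sym (Y≡merge⁻¹X′ v)) ([]=⇒lookup v∈Y))) ,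
      (merge x≢y v′ , λ h → v′∉Y (lookup⇒[]= _ Y (trans (Y≡merge⁻¹X′ v′) ([]=⇒lookup h)))) ,
      λ i → 2∣-respects-oddᵇ (sym (oddᵇ∣T′∩X′∣≡oddᵇ∣T∩Y∣ (merge x≢y) (Ts I i) X′ Y Y≡merge⁻¹X′)) (even i)

  evenCut-contract⇒evenCut : ∀ {m t p} (I : Inst m t (suc p)) (b : NonLoop (ends I)) D →
                             IsEvenCut (contract I b) D → IsEvenCut I D
  evenCut-contract⇒evenCut I (e , x≢y) D (X′ , side , δX′≡D) =
    Y , evenSide-contract⇒evenSide I e x≢y X′ Y Y≡merge⁻¹X′ side , trans (sym (δ-contract I e x≢y X′ Y Y≡merge⁻¹X′)) δX′≡D
    where
    Y = tabulate (λ v → lookup X′ (merge x≢y v))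
    Y≡merge⁻¹X′ = lookup∘tabulate (λ v → lookup X′ (merge x≢y v))

  evenCut-contract : ∀ {m t p} (I : Inst m t (suc p)) (b : NonLoop (ends I)) (Y : Subset (suc p)) →
    lookup (edges I) (proj₁ b) ≡ true → lookup (δ I Y) (proj₁ b) ≡ false → EvenSide I Y →
    IsEvenCut (contract I b) (δ I Y)
  evenCut-contract I (e , x≢y) Y e∈E e∉δY side =
    X′ , evenSide⇒evenSide-contract I e x≢y X′ Y Y≡merge⁻¹X′ side , δ-contract I e x≢y X′ Y Y≡merge⁻¹X′
    where
    x = proj₁ (ends I e)
    y = proj₂ (ends I e)
    X′ = tabulate (λ w → lookup Y (punchIn y w))
    Yx≡Yy : lookup Y x ≡ lookup Y y
    Yx≡Yy = xor≡false⇒≡ (begin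
        lookup Y x xor lookup Y y
      ≡⟨ cong (_∧ (lookup Y x xor lookup Y y)) e∈E ⟨
        lookup (edges I) e ∧ crosses (ends I) Y e
      ≡⟨ lookup∘tabulate (λ f → lookup (edges I) f ∧ crosses (ends I) Y f) e ⟨
        lookup (δ I Y) e
      ≡⟨ e∉δY ⟩
        false ∎)
      where
      open ≡-Reasoning
      xor≡false⇒≡ : ∀ {a b} → a xor b ≡ false → a ≡ b
      xor≡false⇒≡ {true}  {true}  _ = refl
      xor≡false⇒≡ {false} {false} _ = refl
    Y≡merge⁻¹X′ : ∀ v → lookup Y v ≡ lookup X′ (merge x≢y v)
    Y≡merge⁻¹X′ v = sym (trans (lookup∘tabulate (λ w → lookup Y (punchIn y w)) (merge x≢y v))
                               (lookup-punchIn∘merge x≢y Y Yx≡Yy v))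

module Weight where

  open import Data.Nat using (_+_; _*_; _≤_; _^_; _∸_)
  open import Data.Nat.Solver using (module +-*-Solver)

  open +-*-Solver

  -- weight M = M(M−1)(M−2)(M−3) = 4!·C(M,4) for M ≥ 4: the contraction algorithm succeeds with
  -- probability at least 24 / weight (n − 2^t).
  weight : ℕ → ℕ
  weight (suc (suc (suc (suc j)))) = (4 + j) * (3 + j) * (2 + j) * (1 + j)
  weight _                         = 24

  24≤weight : ∀ M → 24 ≤ weight M
  24≤weight 0 = ℕₚ.≤-refl
  24≤weight 1 = ℕₚ.≤-refl
  24≤weight 2 = ℕₚ.≤-refl
  24≤weight 3 = ℕₚ.≤-refl
  24≤weight (suc (suc (suc (suc j)))) =
    ℕₚ.*-mono-≤ (ℕₚ.*-mono-≤ (ℕₚ.*-mono-≤ (ℕₚ.m≤m+n 4 j) (ℕₚ.m≤m+n 3 j)) (ℕₚ.m≤m+n 2 j)) (ℕₚ.m≤m+n 1 j)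

  weight-suc : ∀ j → weight (5 + j) * (1 + j) ≡ (5 + j) * weight (4 + j)
  weight-suc j = solve 1 (λ j → (con 5 :+ j) :* (con 4 :+ j) :* (con 3 :+ j) :* (con 2 :+ j) :* (con 1 :+ j)
                              := (con 5 :+ j) :* ((con 4 :+ j) :* (con 3 :+ j) :* (con 2 :+ j) :* (con 1 :+ j))) refl j

  weight≤^4 : ∀ j → weight (4 + j) ≤ (4 + j) ^ 4
  weight≤^4 j = ℕₚ.≤-trans
    (ℕₚ.*-mono-≤ (ℕₚ.*-mono-≤ (ℕₚ.*-mono-≤ (ℕₚ.≤-refl {4 + j}) (ℕₚ.m≤n+m (3 + j) 1))
                             (ℕₚ.m≤n+m (2 + j) 2))
                 (ℕₚ.m≤n+m (1 + j) 3))
    (ℕₚ.≤-reflexive (solve 1 (λ M → M :* M :* M :* M := M :^ 4) refl (4 + j)))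

  -- If at most a 4/M fraction of the L edges lies in the cut (k·M ≤ 4L), then avoiding them keeps
  -- L·weight(M−1) ≤ (L−k)·weight(M), i.e. (1 − k/L) ≥ (1 − 4/M) = weight(M−1)/weight(M).
  weight-step : ∀ j k L → k * (5 + j) ≤ 4 * L → k ≤ L × weight (4 + j) * L ≤ weight (5 + j) * (L ∸ k)
  weight-step j k L k*M≤4L = k≤L , ℕₚ.*-cancelˡ-≤ (suc j) (begin
      (1 + j) * (weight (4 + j) * L)
    ≡⟨ solve 3 (λ a b c → a :* (b :* c) := b :* (a :* c)) refl (1 + j) (weight (4 + j)) L ⟩
      weight (4 + j) * ((1 + j) * L)
    ≤⟨ ℕₚ.*-monoʳ-≤ (weight (4 + j)) [1+j]*L≤M*r ⟩
      weight (4 + j) * ((5 + j) * r)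
    ≡⟨ solve 3 (λ a b c → a :* (b :* c) := (b :* a) :* c) refl (weight (4 + j)) (5 + j) r ⟩
      ((5 + j) * weight (4 + j)) * r
    ≡⟨ cong (_* r) (weight-suc j) ⟨
      (weight (5 + j) * (1 + j)) * r
    ≡⟨ solve 3 (λ a b c → (a :* b) :* c := b :* (a :* c)) refl (weight (5 + j)) (1 + j) r ⟩
      (1 + j) * (weight (5 + j) * r) ∎)
    where
    open ℕₚ.≤-Reasoning
    r = L ∸ k
    k≤L : k ≤ L
    k≤L = ℕₚ.*-cancelʳ-≤ k L 5 (begin
      k * 5          ≤⟨ ℕₚ.*-monoʳ-≤ k (ℕₚ.m≤m+n 5 j) ⟩
      k * (5 + j)    ≤⟨ k*M≤4L ⟩
      4 * L          ≤⟨ ℕₚ.*-monoˡ-≤ L (ℕₚ.n≤1+n 4) ⟩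
      5 * L          ≡⟨ ℕₚ.*-comm 5 L ⟩
      L * 5          ∎)
    [1+j]*L≤M*r : (1 + j) * L ≤ (5 + j) * r
    [1+j]*L≤M*r = ℕₚ.+-cancelʳ-≤ (4 * L) _ _ (begin
      (1 + j) * L + 4 * L            ≡⟨ cong (λ z → (1 + j) * z + 4 * z) (sym (ℕₚ.m∸n+n≡m k≤L)) ⟩
      (1 + j) * (r + k) + 4 * (r + k) ≡⟨ solve 3 (λ j r k → (con 1 :+ j) :* (r :+ k) :+ con 4 :* (r :+ k)
                                                     := (con 5 :+ j) :* r :+ k :* (con 5 :+ j)) refl j r k ⟩
      (5 + j) * r + k * (5 + j)      ≤⟨ ℕₚ.+-monoʳ-≤ ((5 + j) * r) k*M≤4L ⟩
      (5 + j) * r + 4 * L            ∎)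

  weight[n∸2^t]≤n^4 : ∀ t n → 2 ^ t + 4 ≤ n → weight (n ∸ 2 ^ t) ≤ n ^ 4
  weight[n∸2^t]≤n^4 t n 2^t+4≤n = begin
    weight M                  ≡⟨ cong weight M≡4+[M∸4] ⟩
    weight (4 + (M ∸ 4))      ≤⟨ weight≤^4 (M ∸ 4) ⟩
    (4 + (M ∸ 4)) ^ 4         ≡⟨ cong (_^ 4) M≡4+[M∸4] ⟨
    M ^ 4                     ≤⟨ ℕₚ.^-monoˡ-≤ 4 (ℕₚ.m∸n≤m n (2 ^ t)) ⟩
    n ^ 4                     ∎
    where
    open ℕₚ.≤-Reasoning
    M = n ∸ 2 ^ t
    4≤M : 4 ≤ M
    4≤M = ℕₚ.≤-trans (ℕₚ.≤-reflexive (sym (ℕₚ.m+n∸m≡n (2 ^ t) 4))) (ℕₚ.∸-monoˡ-≤ (2 ^ t) 2^t+4≤n)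
    M≡4+[M∸4] : M ≡ 4 + (M ∸ 4)
    M≡4+[M∸4] = sym (ℕₚ.m+[n∸m]≡n 4≤M)

module Rationals where

  open import Data.Integer as ℤ using (+_)
  import Data.Integer.Properties as ℤₚ
  open import Data.Integer.Solver using (module +-*-Solver)
  open import Data.Rational using (ℚ; _/_; _+_; _*_; _≤_; 0ℚ; 1ℚ; toℚᵘ; nonNegative)
  import Data.Rational.Properties as ℚₚ
  open import Data.Rational.Unnormalised as ℚᵘ using (mkℚᵘ; *≡*; *≤*)
  import Data.Rational.Unnormalised.Properties as ℚᵘₚ

  fromℕ : ℕ → ℚ
  fromℕ n = + n / 1

  1/[1+_] : ℕ → ℚ
  1/[1+ d ] = + 1 / suc d

  private
    toℚᵘ-/ : ∀ a d → toℚᵘ (+ a / suc d) ℚᵘ.≃ mkℚᵘ (+ a) d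
    toℚᵘ-/ a d = ℚₚ.toℚᵘ-fromℚᵘ (mkℚᵘ (+ a) d)

    ≡-via-ℚᵘ : ∀ {p q : ℚ} (p′ q′ : ℚᵘ.ℚᵘ) → toℚᵘ p ℚᵘ.≃ p′ → toℚᵘ q ℚᵘ.≃ q′ → p′ ℚᵘ.≃ q′ → p ≡ q
    ≡-via-ℚᵘ p′ q′ p≃ q≃ eq = ℚₚ.toℚᵘ-injective (ℚᵘₚ.≃-trans p≃ (ℚᵘₚ.≃-trans eq (ℚᵘₚ.≃-sym q≃)))

  open import Data.Integer.Solver using (module +-*-Solver)
  open +-*-Solver

  fromℕ-homo-+ : ∀ a b → fromℕ (a ℕ.+ b) ≡ fromℕ a + fromℕ b
  fromℕ-homo-+ a b = ≡-via-ℚᵘ _ _ (toℚᵘ-/ (a ℕ.+ b) 0)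
    (ℚᵘₚ.≃-trans (ℚₚ.toℚᵘ-homo-+ (fromℕ a) (fromℕ b)) (ℚᵘₚ.+-cong (toℚᵘ-/ a 0) (toℚᵘ-/ b 0)))
    (*≡* (cong (ℤ._* + 1) (trans (ℤₚ.pos-+ a b)
      (solve 2 (λ x y → x :+ y := x :* con (+ 1) :+ y :* con (+ 1)) refl (+ a) (+ b)))))

  fromℕ-homo-* : ∀ a b → fromℕ (a ℕ.* b) ≡ fromℕ a * fromℕ b
  fromℕ-homo-* a b = ≡-via-ℚᵘ _ _ (toℚᵘ-/ (a ℕ.* b) 0)
    (ℚᵘₚ.≃-trans (ℚₚ.toℚᵘ-homo-* (fromℕ a) (fromℕ b)) (ℚᵘₚ.*-cong (toℚᵘ-/ a 0) (toℚᵘ-/ b 0)))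
    (*≡* (cong (ℤ._* + 1) (ℤₚ.pos-* a b)))

  fromℕ-mono-≤ : ∀ {a b} → a ℕ.≤ b → fromℕ a ≤ fromℕ b
  fromℕ-mono-≤ {a} {b} a≤b = ℚₚ.toℚᵘ-cancel-≤
    (ℚᵘₚ.≤-respʳ-≃ (ℚᵘₚ.≃-sym (toℚᵘ-/ b 0)) (ℚᵘₚ.≤-respˡ-≃ (ℚᵘₚ.≃-sym (toℚᵘ-/ a 0))
      (*≤* (ℤₚ.*-monoʳ-≤-nonNeg (+ 1) (ℤ.+≤+ a≤b)))))

  fromℕ-*-1/[1+] : ∀ d → fromℕ (suc d) * 1/[1+ d ] ≡ 1ℚ
  fromℕ-*-1/[1+] d = ≡-via-ℚᵘ _ _
    (ℚᵘₚ.≃-trans (ℚₚ.toℚᵘ-homo-* (fromℕ (suc d)) 1/[1+ d ]) (ℚᵘₚ.*-cong (toℚᵘ-/ (suc d) 0) (toℚᵘ-/ 1 d)))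
    (toℚᵘ-/ 1 0)
    (*≡* (trans (solve 1 (λ z → (z :* con (+ 1)) :* con (+ 1) := con (+ 1) :* z) refl (+ suc d))
      (cong (λ z → + 1 ℤ.* + z) (sym (ℕₚ.*-identityˡ (suc d))))))

  /-≡-fromℕ-*-1/[1+] : ∀ a d → + a / suc d ≡ fromℕ a * 1/[1+ d ]
  /-≡-fromℕ-*-1/[1+] a d = ≡-via-ℚᵘ _ _ (toℚᵘ-/ a d)
    (ℚᵘₚ.≃-trans (ℚₚ.toℚᵘ-homo-* (fromℕ a) 1/[1+ d ]) (ℚᵘₚ.*-cong (toℚᵘ-/ a 0) (toℚᵘ-/ 1 d)))
    (*≡* (trans (cong (λ z → + a ℤ.* + z) (ℕₚ.*-identityˡ (suc d)))
      (solve 2 (λ x z → x :* z := (x :* con (+ 1)) :* z) refl (+ a) (+ suc d))))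

  fromℕ-suc-* : ∀ n q → fromℕ (suc n) * q ≡ fromℕ n * q + q
  fromℕ-suc-* n q = begin
    fromℕ (1 ℕ.+ n) * q      ≡⟨ cong (_* q) (fromℕ-homo-+ 1 n) ⟩
    (1ℚ + fromℕ n) * q       ≡⟨ ℚₚ.*-distribʳ-+ q 1ℚ (fromℕ n) ⟩
    1ℚ * q + fromℕ n * q     ≡⟨ cong (_+ fromℕ n * q) (ℚₚ.*-identityˡ q) ⟩
    q + fromℕ n * q          ≡⟨ ℚₚ.+-comm q (fromℕ n * q) ⟩
    fromℕ n * q + q          ∎
    where open ≡-Reasoning

  0≤1 : 0ℚ ≤ 1ℚ
  0≤1 = ℚₚ.nonNegative⁻¹ 1ℚ

  0≤fromℕ : ∀ n → 0ℚ ≤ fromℕ n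
  0≤fromℕ n = fromℕ-mono-≤ {0} {n} ℕ.z≤n

  0≤1/[1+_] : ∀ d → 0ℚ ≤ 1/[1+ d ]
  0≤1/[1+ d ] = ℚₚ.nonNegative⁻¹ 1/[1+ d ] {{ℚₚ.normalize-nonNeg 1 (suc d)}}

  *-monoˡ-≤-0≤ : ∀ {a p q} → 0ℚ ≤ a → p ≤ q → a * p ≤ a * q
  *-monoˡ-≤-0≤ {a} 0≤a = ℚₚ.*-monoˡ-≤-nonNeg a {{nonNegative 0≤a}}

  *-monoʳ-≤-0≤ : ∀ {a p q} → 0ℚ ≤ a → p ≤ q → p * a ≤ q * a
  *-monoʳ-≤-0≤ {a} 0≤a = ℚₚ.*-monoʳ-≤-nonNeg a {{nonNegative 0≤a}}

  *-mono-≤-0≤ : ∀ {a a′ b b′} → 0ℚ ≤ a → 0ℚ ≤ b → a ≤ a′ → b ≤ b′ → a * b ≤ a′ * b′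
  *-mono-≤-0≤ 0≤a 0≤b a≤a′ b≤b′ =
    ℚₚ.≤-trans (*-monoʳ-≤-0≤ 0≤b a≤a′) (*-monoˡ-≤-0≤ (ℚₚ.≤-trans 0≤a a≤a′) b≤b′)

  0≤* : ∀ {p q} → 0ℚ ≤ p → 0ℚ ≤ q → 0ℚ ≤ p * q
  0≤* {p} 0≤p 0≤q = ℚₚ.≤-trans (ℚₚ.≤-reflexive (sym (ℚₚ.*-zeroʳ p))) (*-monoˡ-≤-0≤ 0≤p 0≤q)

  0≤+ : ∀ {p q} → 0ℚ ≤ p → 0ℚ ≤ q → 0ℚ ≤ p + q
  0≤+ = ℚₚ.+-mono-≤

module Averages where

  open import Data.Nat using (_≤_)
  open import Data.Rational using (ℚ; _+_; _*_; -_; 0ℚ; 1ℚ) renaming (_≤_ to _≤ℚ_)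
  import Data.Rational.Properties as ℚₚ
  open import Data.Rational.Solver using (module +-*-Solver)

  open Rationals
  open Counting using (𝟙)
  open Degrees using (countIn)
  open +-*-Solver
  open ℚₚ.≤-Reasoning

  sumℚ : ∀ {A : Set} → (A → ℚ) → List A → ℚ
  sumℚ g []       = 0ℚ
  sumℚ g (a ∷ as) = g a + sumℚ g as

  average≡sumℚ* : ∀ {A : Set} (g : A → ℚ) a as → average g a as ≡ sumℚ g (a ∷ as) * 1/[1+ length as ]
  average≡sumℚ* g a as = cong (_* 1/[1+ length as ]) (trans (foldr≡sumℚ+ (g a) as) (ℚₚ.+-comm _ (g a)))
    where
    foldr≡sumℚ+ : ∀ z as → List.foldr (λ b r → g b + r) z as ≡ sumℚ g as + z
    foldr≡sumℚ+ z []       = sym (ℚₚ.+-identityˡ z)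
    foldr≡sumℚ+ z (a ∷ as) = trans (cong (g a +_) (foldr≡sumℚ+ z as)) (sym (ℚₚ.+-assoc (g a) _ z))

  InUnit : ℚ → Set
  InUnit q = 0ℚ ≤ℚ q × q ≤ℚ 1ℚ

  average-InUnit : ∀ {A : Set} (g : A → ℚ) a as → (∀ b → InUnit (g b)) → InUnit (average g a as)
  average-InUnit g a as g∈[0,1] rewrite average≡sumℚ* g a as =
    0≤* (proj₁ Σ∈[0,L]) 0≤1/[1+ length as ] ,
    ℚₚ.≤-trans (*-monoʳ-≤-0≤ 0≤1/[1+ length as ] (proj₂ Σ∈[0,L])) (ℚₚ.≤-reflexive (fromℕ-*-1/[1+] (length as)))
    where
    sumℚ∈[0,length] : ∀ l → 0ℚ ≤ℚ sumℚ g l × sumℚ g l ≤ℚ fromℕ (length l)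
    sumℚ∈[0,length] []      = ℚₚ.≤-refl , ℚₚ.≤-refl
    sumℚ∈[0,length] (b ∷ l) = 0≤+ (proj₁ (g∈[0,1] b)) (proj₁ (sumℚ∈[0,length] l)) ,
      ℚₚ.≤-trans (ℚₚ.+-mono-≤ (proj₂ (g∈[0,1] b)) (proj₂ (sumℚ∈[0,length] l))) (ℚₚ.≤-reflexive (sym (fromℕ-homo-+ 1 (length l))))
    Σ∈[0,L] = sumℚ∈[0,length] (a ∷ as)

  24*length≤P*sumℚ+24*countIn : ∀ {m} {E : Fin m → Set} (C : Subset m) (g : Σ (Fin m) E → ℚ) (P : ℕ) l →
    (∀ b → 0ℚ ≤ℚ g b) → All (λ b → lookup C (proj₁ b) ≡ false → fromℕ 24 ≤ℚ fromℕ P * g b) l →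
    fromℕ (24 ℕ.* length l) ≤ℚ fromℕ P * sumℚ g l + fromℕ (24 ℕ.* countIn C l)
  24*length≤P*sumℚ+24*countIn C g P [] 0≤g [] =
    ℚₚ.≤-reflexive (sym (trans (cong (_+ 0ℚ) (ℚₚ.*-zeroʳ (fromℕ P))) (ℚₚ.+-identityʳ 0ℚ)))
  24*length≤P*sumℚ+24*countIn C g P (b ∷ l) 0≤g (b∉C⇒ ∷ l∉C⇒) = begin
      fromℕ (24 ℕ.* suc (length l))
    ≡⟨ trans (cong fromℕ (ℕₚ.*-suc 24 (length l))) (fromℕ-homo-+ 24 (24 ℕ.* length l)) ⟩
      fromℕ 24 + fromℕ (24 ℕ.* length l)
    ≤⟨ ℚₚ.+-mono-≤ (single (lookup C (proj₁ b)) refl) (24*length≤P*sumℚ+24*countIn C g P l 0≤g l∉C⇒) ⟩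
      (fromℕ P * g b + fromℕ (24 ℕ.* cb)) + (fromℕ P * sumℚ g l + fromℕ (24 ℕ.* countIn C l))
    ≡⟨ solve 5 (λ P a b S c → (P :* a :+ b) :+ (P :* S :+ c) := P :* (a :+ S) :+ (b :+ c))
               refl (fromℕ P) (g b) (fromℕ (24 ℕ.* cb)) (sumℚ g l) (fromℕ (24 ℕ.* countIn C l)) ⟩
      fromℕ P * (g b + sumℚ g l) + (fromℕ (24 ℕ.* cb) + fromℕ (24 ℕ.* countIn C l))
    ≡⟨ cong (fromℕ P * (g b + sumℚ g l) +_)
            (trans (sym (fromℕ-homo-+ (24 ℕ.* cb) _)) (cong fromℕ (sym (ℕₚ.*-distribˡ-+ 24 cb (countIn C l))))) ⟩
      fromℕ P * (g b + sumℚ g l) + fromℕ (24 ℕ.* (cb ℕ.+ countIn C l)) ∎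
    where
    cb = 𝟙 (lookup C (proj₁ b))
    single : ∀ β → lookup C (proj₁ b) ≡ β → fromℕ 24 ≤ℚ fromℕ P * g b + fromℕ (24 ℕ.* 𝟙 β)
    single true  _   = begin
      fromℕ 24                      ≡⟨ ℚₚ.+-identityˡ (fromℕ 24) ⟨
      0ℚ + fromℕ 24                 ≤⟨ ℚₚ.+-monoˡ-≤ (fromℕ 24) (0≤* (0≤fromℕ P) (0≤g b)) ⟩
      fromℕ P * g b + fromℕ 24      ∎
    single false b∉C = begin
      fromℕ 24                      ≤⟨ b∉C⇒ b∉C ⟩
      fromℕ P * g b                 ≡⟨ ℚₚ.+-identityʳ (fromℕ P * g b) ⟨
      fromℕ P * g b + 0ℚ            ∎

  24≤Q*S/L : ∀ (P Q r k L′ : ℕ) (S : ℚ) → fromℕ (24 ℕ.* suc L′) ≤ℚ fromℕ P * S + fromℕ (24 ℕ.* k) →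
    suc L′ ≡ r ℕ.+ k → P ℕ.* suc L′ ≤ Q ℕ.* r → 1 ≤ P → fromℕ 24 ≤ℚ fromℕ Q * (S * 1/[1+ L′ ])
  24≤Q*S/L P Q r k L′ S 24L≤PS+24k L≡r+k PL≤Qr 1≤P = begin
      fromℕ 24
    ≡⟨ trans (sym (ℚₚ.*-identityʳ (fromℕ 24))) (cong (fromℕ 24 *_) (sym (fromℕ-*-1/[1+] L′))) ⟩
      fromℕ 24 * (fromℕ L * 1/[1+ L′ ])
    ≡⟨ trans (sym (ℚₚ.*-assoc (fromℕ 24) (fromℕ L) _)) (cong (_* 1/[1+ L′ ]) (sym (fromℕ-homo-* 24 L))) ⟩
      fromℕ (24 ℕ.* L) * 1/[1+ L′ ]
    ≤⟨ *-monoʳ-≤-0≤ 0≤1/[1+ L′ ] 24L≤QS ⟩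
      (fromℕ Q * S) * 1/[1+ L′ ]
    ≡⟨ ℚₚ.*-assoc (fromℕ Q) S 1/[1+ L′ ] ⟩
      fromℕ Q * (S * 1/[1+ L′ ]) ∎
    where
    L = suc L′
    24r≤PS : fromℕ (24 ℕ.* r) ≤ℚ fromℕ P * S
    24r≤PS = +-cancelʳ-≤ (fromℕ (24 ℕ.* k)) (begin
      fromℕ (24 ℕ.* r) + fromℕ (24 ℕ.* k)   ≡⟨ fromℕ-homo-+ (24 ℕ.* r) (24 ℕ.* k) ⟨
      fromℕ (24 ℕ.* r ℕ.+ 24 ℕ.* k)         ≡⟨ cong fromℕ (trans (sym (ℕₚ.*-distribˡ-+ 24 r k)) (cong (24 ℕ.*_) (sym L≡r+k))) ⟩
      fromℕ (24 ℕ.* L)                       ≤⟨ 24L≤PS+24k ⟩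
      fromℕ P * S + fromℕ (24 ℕ.* k)         ∎)
      where
      +-cancelʳ-≤ : ∀ {a b} c → a + c ≤ℚ b + c → a ≤ℚ b
      +-cancelʳ-≤ {a} {b} c a+c≤b+c = begin
        a                ≡⟨ solve 2 (λ a c → a := (a :+ c) :+ (:- c)) refl a c ⟩
        (a + c) + - c    ≤⟨ ℚₚ.+-monoˡ-≤ (- c) a+c≤b+c ⟩
        (b + c) + - c    ≡⟨ solve 2 (λ b c → (b :+ c) :+ (:- c) := b) refl b c ⟩
        b                ∎
    24L≤QS : fromℕ (24 ℕ.* L) ≤ℚ fromℕ Q * S
    24L≤QS = ℚₚ.*-cancelˡ-≤-pos (fromℕ P) {{ℚₚ.normalize-pos P 1 {{_}} {{ℕ.>-nonZero 1≤P}}}} (begin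
      fromℕ P * fromℕ (24 ℕ.* L)      ≡⟨ fromℕ-homo-* P (24 ℕ.* L) ⟨
      fromℕ (P ℕ.* (24 ℕ.* L))         ≡⟨ cong fromℕ (ℕ-solve 3 (λ P a L → P ℕ:* (a ℕ:* L) ℕ:= a ℕ:* (P ℕ:* L)) refl P 24 L) ⟩
      fromℕ (24 ℕ.* (P ℕ.* L))         ≤⟨ fromℕ-mono-≤ (ℕₚ.*-monoʳ-≤ 24 PL≤Qr) ⟩
      fromℕ (24 ℕ.* (Q ℕ.* r))         ≡⟨ cong fromℕ (ℕ-solve 3 (λ a Q r → a ℕ:* (Q ℕ:* r) ℕ:= Q ℕ:* (a ℕ:* r)) refl 24 Q r) ⟩
      fromℕ (Q ℕ.* (24 ℕ.* r))         ≡⟨ fromℕ-homo-* Q (24 ℕ.* r) ⟩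
      fromℕ Q * fromℕ (24 ℕ.* r)      ≤⟨ *-monoˡ-≤-0≤ (0≤fromℕ Q) 24r≤PS ⟩
      fromℕ Q * (fromℕ P * S)         ≡⟨ solve 3 (λ a b c → a :* (b :* c) := b :* (a :* c)) refl (fromℕ Q) (fromℕ P) S ⟩
      fromℕ P * (fromℕ Q * S)         ∎)
      where
      open import Data.Nat.Solver using () renaming (module +-*-Solver to ℕ-Solver)
      open ℕ-Solver using () renaming (solve to ℕ-solve; _:*_ to _ℕ:*_; _:=_ to _ℕ:=_)

module RandomContraction
  {t m n : ℕ} (ends₀ : Fin m → Fin n × Fin n) (T₀ : Fin t → Subset n) (k : ℕ)
  (C₀ : Subset m) (C₀-cut : IsEvenCut (inst ⊤ ends₀ T₀) C₀) (∣C₀∣≡k : ∣ C₀ ∣ ≡ k)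
  (k≤cuts : ∀ C → IsEvenCut (inst ⊤ ends₀ T₀) C → k ℕ.≤ ∣ C ∣)
  (search : Search m t)
  (search-min : ∀ {n'} (I : Inst m t n') → n' ℕ.≤ 2 ℕ.^ t ℕ.+ 4 → Σ (Subset m) (IsEvenCut I) → IsMinEvenCut I (search I))
  (good? : (C : Subset m) → Dec (IsEvenCut (inst ⊤ ends₀ T₀) C × ∣ C ∣ ≡ k)) where

  open import Data.Nat using (_≤_; _^_; _∸_)
  open import Data.Rational using (ℚ; _+_; _*_; 0ℚ; 1ℚ) renaming (_≤_ to _≤ℚ_)
  import Data.Rational.Properties as ℚₚ
  open import Data.Rational.Solver using (module +-*-Solver)

  open Rationals
  open Counting using (𝟙)
  open Degrees
  open LowDegreeVertices using (k*[n∸2^t]≤4*nonLoops)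
  open Contraction using (evenCut-contract⇒evenCut; evenCut-contract)
  open Weight
  open Averages

  original : Inst m t n
  original = inst ⊤ ends₀ T₀

  Good : Subset m → Set
  Good C = IsEvenCut original C × ∣ C ∣ ≡ k

  success : (n' : ℕ) → Inst m t n' → ℚ
  success = successProb Good good? search

  indicator : Subset m → ℚ
  indicator C = if does (good? C) then 1ℚ else 0ℚ

  indicator-InUnit : ∀ C → InUnit (indicator C)
  indicator-InUnit C with does (good? C)
  ... | true  = 0≤1 , ℚₚ.≤-refl
  ... | false = ℚₚ.≤-refl , 0≤1

  indicator-good : ∀ C → Good C → indicator C ≡ 1ℚ
  indicator-good C good with good? C
  ... | yes _   = refl
  ... | no ¬good = ⊥-elim (¬good good)

  success-InUnit : ∀ n' (I : Inst m t n') → InUnit (success n' I)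
  success-InUnit zero    I = indicator-InUnit (search (deleteLoops I))
  success-InUnit (suc p) I with suc p ℕ.≤? 2 ^ t ℕ.+ 4 | nonLoopList (deleteLoops I) (allFin m)
  ... | yes _ | _      = indicator-InUnit (search (deleteLoops I))
  ... | no _  | []     = indicator-InUnit ⊥
  ... | no _  | a ∷ as = average-InUnit (λ b → success p (contract (deleteLoops I) b)) a as
                                        (λ b → success-InUnit p (contract (deleteLoops I) b))

  -- The invariant of a run that has not yet contracted an edge of C₀.
  Faithful : ∀ {n'} → Inst m t n' → Set
  Faithful I = IsEvenCut I C₀ × (∀ D → IsEvenCut I D → IsEvenCut original D)

  evenCut-deleteLoops⇒evenCut : ∀ {n'} (I : Inst m t n') D → IsEvenCut (deleteLoops I) D → IsEvenCut I D
  evenCut-deleteLoops⇒evenCut I D (X , side , δX≡D) = X , side , trans (sym (δ-deleteLoops I X)) δX≡D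

  evenCut⇒evenCut-deleteLoops : ∀ {n'} (I : Inst m t n') D → IsEvenCut I D → IsEvenCut (deleteLoops I) D
  evenCut⇒evenCut-deleteLoops I D (X , side , δX≡D) = X , side , trans (δ-deleteLoops I X) δX≡D

  search-good : ∀ {n'} (I : Inst m t n') → n' ≤ 2 ^ t ℕ.+ 4 → Faithful I → Good (search (deleteLoops I))
  search-good I small (C₀-cutI , faithful) =
    S-cut , ℕₚ.≤-antisym (ℕₚ.≤-trans (proj₂ S-min C₀ C₀-cutI′) (ℕₚ.≤-reflexive ∣C₀∣≡k)) (k≤cuts S S-cut)
    where
    S = search (deleteLoops I)
    C₀-cutI′ = evenCut⇒evenCut-deleteLoops I C₀ C₀-cutI
    S-min = search-min (deleteLoops I) small (C₀ , C₀-cutI′)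
    S-cut = faithful S (evenCut-deleteLoops⇒evenCut I S (proj₁ S-min))

  -- Cut edges are never loops, so without non-loop edges C₀ is empty.
  ∅-good : ∀ {n'} (I : Inst m t n') → nonLoopList (deleteLoops I) (allFin m) ≡ [] → Faithful I → Good ⊥
  ∅-good I none ((X , _ , δX≡C₀) , _) = subst Good C₀≡⊥ (C₀-cut , ∣C₀∣≡k)
    where
    C₀≡⊥ : C₀ ≡ ⊥
    C₀≡⊥ = trans (sym δX≡C₀) (trans (sym (δ-deleteLoops I X))
             (nonLoops≡0⇒δ≡⊥ (deleteLoops I) X (trans (sym (length-nonLoopList-allFin (deleteLoops I))) (cong length none))))

  faithful-contract : ∀ {p} (I : Inst m t (suc p)) (b : NonLoop (ends (deleteLoops I))) →
    lookup (edges (deleteLoops I)) (proj₁ b) ≡ true → lookup C₀ (proj₁ b) ≡ false →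
    Faithful I → Faithful (contract (deleteLoops I) b)
  faithful-contract I b b∈E b∉C₀ ((X , side , δX≡C₀) , faithful) =
    subst (IsEvenCut (contract (deleteLoops I) b)) δ′X≡C₀ (evenCut-contract (deleteLoops I) b X b∈E b∉δ′X side) ,
    λ D D-cut → faithful D (evenCut-deleteLoops⇒evenCut I D (evenCut-contract⇒evenCut (deleteLoops I) b D D-cut))
    where
    δ′X≡C₀ : δ (deleteLoops I) X ≡ C₀
    δ′X≡C₀ = trans (δ-deleteLoops I X) δX≡C₀
    b∉δ′X : lookup (δ (deleteLoops I) X) (proj₁ b) ≡ false
    b∉δ′X = trans (cong (λ Z → lookup Z (proj₁ b)) δ′X≡C₀) b∉C₀

  beyond-search-threshold : ∀ {p} → ¬ suc p ≤ 2 ^ t ℕ.+ 4 →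
    Σ ℕ λ j → p ∸ 2 ^ t ≡ 4 ℕ.+ j × suc p ∸ 2 ^ t ≡ 5 ℕ.+ j × 3 ≤ suc p
  beyond-search-threshold {p} large = j , p∸2^t≡4+j , suc-p∸2^t≡5+j , 3≤suc-p
    where
    2^t+4≤p : 2 ^ t ℕ.+ 4 ≤ p
    2^t+4≤p = ℕₚ.≤-pred (ℕₚ.≰⇒> large)
    j = p ∸ (2 ^ t ℕ.+ 4)
    p∸2^t≡4+j : p ∸ 2 ^ t ≡ 4 ℕ.+ j
    p∸2^t≡4+j = trans (cong (_∸ 2 ^ t) (trans (sym (ℕₚ.m+[n∸m]≡n 2^t+4≤p)) (ℕₚ.+-assoc (2 ^ t) 4 j)))
                      (ℕₚ.m+n∸m≡n (2 ^ t) (4 ℕ.+ j))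
    suc-p∸2^t≡5+j : suc p ∸ 2 ^ t ≡ 5 ℕ.+ j
    suc-p∸2^t≡5+j = trans (ℕₚ.+-∸-assoc 1 (ℕₚ.≤-trans (ℕₚ.m≤m+n (2 ^ t) 4) 2^t+4≤p)) (cong suc p∸2^t≡4+j)
    3≤suc-p : 3 ≤ suc p
    3≤suc-p = ℕₚ.≤-trans (ℕₚ.≤-trans (ℕₚ.n≤1+n 3) (ℕₚ.m≤n+m 4 (2 ^ t))) (ℕₚ.≤-trans 2^t+4≤p (ℕₚ.n≤1+n p))

  -- One contraction step: at most k of the L edges lie in C₀, and k·(n′ − 2^t) ≤ 4L.
  success-≥-step : ∀ {p} (I : Inst m t (suc p)) → Faithful I → ¬ suc p ≤ 2 ^ t ℕ.+ 4 →
    ∀ {a as} → nonLoopList (deleteLoops I) (allFin m) ≡ a ∷ as →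
    (∀ I′ → Faithful I′ → fromℕ 24 ≤ℚ fromℕ (weight (p ∸ 2 ^ t)) * success p I′) →
    fromℕ 24 ≤ℚ fromℕ (weight (suc p ∸ 2 ^ t)) * average (λ b → success p (contract (deleteLoops I) b)) a as
  success-≥-step {p} I faithful large {a} {as} list≡ IH with beyond-search-threshold large
  ... | j , p∸2^t≡4+j , suc-p∸2^t≡5+j , 3≤suc-p
    rewrite suc-p∸2^t≡5+j | average≡sumℚ* (λ b → success p (contract (deleteLoops I) b)) a as =
    24≤Q*S/L (weight (4 ℕ.+ j)) (weight (5 ℕ.+ j)) (L ∸ k) k (length as) (sumℚ g (a ∷ as))
      24L≤ (sym (ℕₚ.m∸n+n≡m (proj₁ weights))) (proj₂ weights) (ℕₚ.≤-trans (ℕ.s≤s ℕ.z≤n) (24≤weight (4 ℕ.+ j)))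
    where
    I′ = deleteLoops I
    g : NonLoop (ends I′) → ℚ
    g b = success p (contract I′ b)
    L = suc (length as)
    L≡nonLoops : L ≡ nonLoops I′
    L≡nonLoops = trans (cong length (sym list≡)) (length-nonLoopList-allFin I′)
    IH-on-list : All (λ b → lookup C₀ (proj₁ b) ≡ false → fromℕ 24 ≤ℚ fromℕ (weight (4 ℕ.+ j)) * g b) (a ∷ as)
    IH-on-list = All.map
      (λ {b} b∈E b∉C₀ → subst (λ M → fromℕ 24 ≤ℚ fromℕ (weight M) * g b) p∸2^t≡4+j
                               (IH (contract I′ b) (faithful-contract I b b∈E b∉C₀ faithful)))
      (subst (All (λ b → lookup (edges I′) (proj₁ b) ≡ true)) list≡ (nonLoopList-present I′ (allFin m)))
    countIn≤k : countIn C₀ (a ∷ as) ≤ k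
    countIn≤k = ℕₚ.≤-trans (subst (λ l → countIn C₀ l ≤ ∣ C₀ ∣) list≡ (countIn-nonLoopList-allFin I′ C₀))
                           (ℕₚ.≤-reflexive ∣C₀∣≡k)
    24L≤ : fromℕ (24 ℕ.* L) ≤ℚ fromℕ (weight (4 ℕ.+ j)) * sumℚ g (a ∷ as) + fromℕ (24 ℕ.* k)
    24L≤ = ℚₚ.≤-trans
      (24*length≤P*sumℚ+24*countIn C₀ g (weight (4 ℕ.+ j)) (a ∷ as) (λ b → proj₁ (success-InUnit p (contract I′ b))) IH-on-list)
      (ℚₚ.+-monoʳ-≤ (fromℕ (weight (4 ℕ.+ j)) * sumℚ g (a ∷ as)) (fromℕ-mono-≤ (ℕₚ.*-monoʳ-≤ 24 countIn≤k)))
    k*M≤4L : k ℕ.* (5 ℕ.+ j) ≤ 4 ℕ.* L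
    k*M≤4L = subst₂ (λ M E → k ℕ.* M ≤ 4 ℕ.* E) suc-p∸2^t≡5+j (sym L≡nonLoops)
      (k*[n∸2^t]≤4*nonLoops I′ k (λ D D-cut → k≤cuts D (proj₂ faithful D (evenCut-deleteLoops⇒evenCut I D D-cut)))
                                 3≤suc-p)
    weights = weight-step j k L k*M≤4L

  good⇒24≤weight*indicator : ∀ {C} M → Good C → fromℕ 24 ≤ℚ fromℕ (weight M) * indicator C
  good⇒24≤weight*indicator {C} M good rewrite indicator-good C good =
    ℚₚ.≤-trans (fromℕ-mono-≤ (24≤weight M)) (ℚₚ.≤-reflexive (sym (ℚₚ.*-identityʳ (fromℕ (weight M)))))

  success-≥ : ∀ n' (I : Inst m t n') → Faithful I → fromℕ 24 ≤ℚ fromℕ (weight (n' ∸ 2 ^ t)) * success n' I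
  success-≥ zero I ((_ , (((() , _) , _) , _)) , _)
  success-≥ (suc p) I faithful with suc p ℕ.≤? 2 ^ t ℕ.+ 4 | nonLoopList (deleteLoops I) (allFin m) in list≡
  ... | yes small | _      = good⇒24≤weight*indicator (suc p ∸ 2 ^ t) (search-good I small faithful)
  ... | no _      | []     = good⇒24≤weight*indicator (suc p ∸ 2 ^ t) (∅-good I list≡ faithful)
  ... | no large  | a ∷ as = success-≥-step I faithful large list≡ (success-≥ p)

  success≡1 : ∀ n' (I : Inst m t n') → n' ≤ 2 ^ t ℕ.+ 4 → Faithful I → success n' I ≡ 1ℚ
  success≡1 zero I _ ((_ , (((() , _) , _) , _)) , _)
  success≡1 (suc p) I small faithful with suc p ℕ.≤? 2 ^ t ℕ.+ 4 | nonLoopList (deleteLoops I) (allFin m)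
  ... | yes small′ | _ = indicator-good _ (search-good I small′ faithful)
  ... | no large   | _ = ⊥-elim (large small)

  1≤n : 1 ≤ n
  1≤n = nonempty (proj₁ (proj₁ (proj₁ (proj₂ C₀-cut))))
    where
    nonempty : ∀ {n'} → Fin n' → 1 ≤ n'
    nonempty zero    = ℕ.s≤s ℕ.z≤n
    nonempty (suc _) = ℕ.s≤s ℕ.z≤n

  faithful-original : Faithful original
  faithful-original = C₀-cut , λ D D-cut → D-cut

  24c≤cn⁴*success : ∀ c → 2 ^ t ℕ.+ 4 ≤ n → fromℕ (24 ℕ.* c) ≤ℚ fromℕ (c ℕ.* n ^ 4) * success n original
  24c≤cn⁴*success c large = begin
      fromℕ (24 ℕ.* c)
    ≡⟨ fromℕ-homo-* 24 c ⟩
      fromℕ 24 * fromℕ c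
    ≤⟨ *-monoʳ-≤-0≤ (0≤fromℕ c) (success-≥ n original faithful-original) ⟩
      (fromℕ (weight (n ∸ 2 ^ t)) * s) * fromℕ c
    ≤⟨ *-monoʳ-≤-0≤ (0≤fromℕ c) (*-monoʳ-≤-0≤ (proj₁ (success-InUnit n original))
                                         (fromℕ-mono-≤ (weight[n∸2^t]≤n^4 t n large))) ⟩
      (fromℕ (n ^ 4) * s) * fromℕ c
    ≡⟨ solve 3 (λ a s c → (a :* s) :* c := (c :* a) :* s) refl (fromℕ (n ^ 4)) s (fromℕ c) ⟩
      (fromℕ c * fromℕ (n ^ 4)) * s
    ≡⟨ cong (_* s) (fromℕ-homo-* c (n ^ 4)) ⟨
      fromℕ (c ℕ.* n ^ 4) * s ∎
    where
    open ℚₚ.≤-Reasoning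
    open +-*-Solver
    s = success n original

module ExpSeries where

  open import Data.Rational using (ℚ; _+_; _*_; _-_; -_; _≤_; 0ℚ; 1ℚ)
  import Data.Rational.Properties as ℚₚ
  open import Data.Rational.Solver using (module +-*-Solver)

  open Rationals
  open +-*-Solver
  open ℚₚ.≤-Reasoning

  term : ℚ → ℕ → ℚ
  term q zero    = 1ℚ
  term q (suc i) = term q i * (q * 1/[1+ i ])

  partial : ℚ → ℕ → ℚ
  partial q zero    = 1ℚ
  partial q (suc j) = partial q j + term q (suc j)

  expTerm≡term : ∀ a i → expTerm a i ≡ term (fromℕ a) i
  expTerm≡term a zero    = refl
  expTerm≡term a (suc i) = cong₂ _*_ (expTerm≡term a i) (/-≡-fromℕ-*-1/[1+] a i)

  expPartial≡partial : ∀ a j → expPartial a j ≡ partial (fromℕ a) j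
  expPartial≡partial a zero    = refl
  expPartial≡partial a (suc j) = cong₂ _+_ (expPartial≡partial a j) (expTerm≡term a (suc j))

  0≤term : ∀ {q} → 0ℚ ≤ q → ∀ i → 0ℚ ≤ term q i
  0≤term 0≤q zero    = 0≤1
  0≤term 0≤q (suc i) = 0≤* (0≤term 0≤q i) (0≤* 0≤q 0≤1/[1+ i ])

  term-mono-≤ : ∀ {q q′} → 0ℚ ≤ q → q ≤ q′ → ∀ i → term q i ≤ term q′ i
  term-mono-≤ 0≤q q≤q′ zero    = ℚₚ.≤-refl
  term-mono-≤ 0≤q q≤q′ (suc i) = *-mono-≤-0≤ (0≤term 0≤q i) (0≤* 0≤q 0≤1/[1+ i ])
    (term-mono-≤ 0≤q q≤q′ i) (*-monoʳ-≤-0≤ 0≤1/[1+ i ] q≤q′)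

  partial-mono-≤ : ∀ {q q′} → 0ℚ ≤ q → q ≤ q′ → ∀ j → partial q j ≤ partial q′ j
  partial-mono-≤ 0≤q q≤q′ zero    = ℚₚ.≤-refl
  partial-mono-≤ 0≤q q≤q′ (suc j) = ℚₚ.+-mono-≤ (partial-mono-≤ 0≤q q≤q′ j) (term-mono-≤ 0≤q q≤q′ (suc j))

  partial-≤-partial-suc : ∀ {q} → 0ℚ ≤ q → ∀ j → partial q j ≤ partial q (suc j)
  partial-≤-partial-suc {q} 0≤q j = begin
    partial q j                         ≡⟨ ℚₚ.+-identityʳ (partial q j) ⟨
    partial q j + 0ℚ                    ≤⟨ ℚₚ.+-monoʳ-≤ (partial q j) (0≤term 0≤q (suc j)) ⟩
    partial q j + term q (suc j)        ∎

  -- Termwise form of  e^(x+y) ≤ e^x + y·e^(x+y),  i.e. of  (x+y)^(i+1) − x^(i+1) ≤ (i+1)·y·(x+y)^i.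
  term-+-≤ : ∀ {x y} → 0ℚ ≤ x → 0ℚ ≤ y → ∀ i → term (x + y) (suc i) ≤ term x (suc i) + y * term (x + y) i
  term-+-≤ {x} {y} 0≤x 0≤y zero = ℚₚ.≤-reflexive
    (solve 2 (λ x y → con 1ℚ :* ((x :+ y) :* con 1ℚ) := con 1ℚ :* (x :* con 1ℚ) :+ y :* con 1ℚ) refl x y)
  term-+-≤ {x} {y} 0≤x 0≤y (suc i) = begin
      U * (z * ρ)
    ≡⟨ solve 4 (λ U x y ρ → U :* ((x :+ y) :* ρ) := U :* (x :* ρ) :+ y :* U :* ρ) refl U x y ρ ⟩
      U * (x * ρ) + y * U * ρ
    ≤⟨ ℚₚ.+-monoˡ-≤ (y * U * ρ) (*-monoʳ-≤-0≤ (0≤* 0≤x 0≤1/[1+ suc i ]) (term-+-≤ 0≤x 0≤y i)) ⟩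
      (W + y * V) * (x * ρ) + y * U * ρ
    ≡⟨ solve 6 (λ W y V x ρ U → (W :+ y :* V) :* (x :* ρ) :+ y :* U :* ρ
                                := W :* (x :* ρ) :+ (y :* (V :* x) :* ρ :+ y :* U :* ρ)) refl W y V x ρ U ⟩
      W * (x * ρ) + (y * (V * x) * ρ + y * U * ρ)
    ≤⟨ ℚₚ.+-monoʳ-≤ (W * (x * ρ)) (ℚₚ.+-monoˡ-≤ (y * U * ρ)
         (*-monoʳ-≤-0≤ 0≤1/[1+ suc i ] (*-monoˡ-≤-0≤ 0≤y (*-monoˡ-≤-0≤ (0≤term 0≤z i) x≤z)))) ⟩
      W * (x * ρ) + (y * (V * z) * ρ + y * U * ρ)
    ≡⟨ cong (λ w → W * (x * ρ) + (y * w * ρ + y * U * ρ)) V*z≡U*[i+1] ⟩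
      W * (x * ρ) + (y * (U * fromℕ (suc i)) * ρ + y * U * ρ)
    ≡⟨ cong (λ w → W * (x * ρ) + w) (solve 4 (λ y U k ρ → y :* (U :* k) :* ρ :+ y :* U :* ρ := y :* U :* ((k :* ρ) :+ ρ))
                                      refl y U (fromℕ (suc i)) ρ) ⟩
      W * (x * ρ) + y * U * (fromℕ (suc i) * ρ + ρ)
    ≡⟨ cong (λ w → W * (x * ρ) + y * U * w) (trans (sym (fromℕ-suc-* (suc i) ρ)) (fromℕ-*-1/[1+] (suc i))) ⟩
      W * (x * ρ) + y * U * 1ℚ
    ≡⟨ cong (λ w → W * (x * ρ) + w) (ℚₚ.*-identityʳ (y * U)) ⟩
      W * (x * ρ) + y * U ∎
    where
    z = x + y
    0≤z = 0≤+ 0≤x 0≤y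
    U = term z (suc i)
    V = term z i
    W = term x (suc i)
    ρ = 1/[1+ suc i ]
    x≤z : x ≤ z
    x≤z = begin x ≡⟨ ℚₚ.+-identityʳ x ⟨ x + 0ℚ ≤⟨ ℚₚ.+-monoʳ-≤ x 0≤y ⟩ x + y ∎
    V*z≡U*[i+1] : V * z ≡ U * fromℕ (suc i)
    V*z≡U*[i+1] = sym (begin-equality
      V * (z * 1/[1+ i ]) * fromℕ (suc i)    ≡⟨ solve 4 (λ V z a b → V :* (z :* a) :* b := V :* z :* (b :* a)) refl
                                                           V z 1/[1+ i ] (fromℕ (suc i)) ⟩
      V * z * (fromℕ (suc i) * 1/[1+ i ])    ≡⟨ cong (V * z *_) (fromℕ-*-1/[1+] i) ⟩
      V * z * 1ℚ                             ≡⟨ ℚₚ.*-identityʳ (V * z) ⟩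
      V * z                                  ∎)

  partial-suc-+-≤ : ∀ {x y} → 0ℚ ≤ x → 0ℚ ≤ y → ∀ j →
                    partial (x + y) (suc j) ≤ partial x (suc j) + y * partial (x + y) j
  partial-suc-+-≤ {x} {y} 0≤x 0≤y zero = begin
      1ℚ + term (x + y) 1
    ≤⟨ ℚₚ.+-monoʳ-≤ 1ℚ (term-+-≤ 0≤x 0≤y 0) ⟩
      1ℚ + (term x 1 + y * 1ℚ)
    ≡⟨ ℚₚ.+-assoc 1ℚ (term x 1) (y * 1ℚ) ⟨
      (1ℚ + term x 1) + y * 1ℚ ∎
  partial-suc-+-≤ {x} {y} 0≤x 0≤y (suc j) = begin
      S z (suc j) + term z (suc (suc j))
    ≤⟨ ℚₚ.+-mono-≤ (partial-suc-+-≤ 0≤x 0≤y j) (term-+-≤ 0≤x 0≤y (suc j)) ⟩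
      (S x (suc j) + y * S z j) + (term x (suc (suc j)) + y * term z (suc j))
    ≡⟨ solve 5 (λ a b c d y → (a :+ y :* b) :+ (c :+ y :* d) := (a :+ c) :+ y :* (b :+ d))
               refl (S x (suc j)) (S z j) (term x (suc (suc j))) (term z (suc j)) y ⟩
      S x (suc (suc j)) + y * S z (suc j) ∎
    where
    S = partial
    z = x + y

  partial-+-≤ : ∀ {x y} → 0ℚ ≤ x → 0ℚ ≤ y → ∀ j → partial (x + y) j ≤ partial x j + y * partial (x + y) j
  partial-+-≤ {x} {y} 0≤x 0≤y zero = begin
    1ℚ              ≡⟨ ℚₚ.+-identityʳ 1ℚ ⟨
    1ℚ + 0ℚ         ≤⟨ ℚₚ.+-monoʳ-≤ 1ℚ (0≤* 0≤y 0≤1) ⟩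
    1ℚ + y * 1ℚ     ∎
  partial-+-≤ {x} {y} 0≤x 0≤y (suc j) = ℚₚ.≤-trans (partial-suc-+-≤ 0≤x 0≤y j)
    (ℚₚ.+-monoʳ-≤ (partial x (suc j)) (*-monoˡ-≤-0≤ 0≤y (partial-≤-partial-suc (0≤+ 0≤x 0≤y) j)))

  [1-y]*partial[x+y]≤partial[x] : ∀ {x y} → 0ℚ ≤ x → 0ℚ ≤ y → ∀ j → (1ℚ - y) * partial (x + y) j ≤ partial x j
  [1-y]*partial[x+y]≤partial[x] {x} {y} 0≤x 0≤y j = begin
      (1ℚ - y) * A
    ≡⟨ solve 2 (λ y A → (con 1ℚ :- y) :* A := A :+ (:- (y :* A))) refl y A ⟩
      A + - (y * A)
    ≤⟨ ℚₚ.+-monoˡ-≤ (- (y * A)) (partial-+-≤ 0≤x 0≤y j) ⟩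
      (partial x j + y * A) + - (y * A)
    ≡⟨ solve 2 (λ B C → (B :+ C) :+ (:- C) := B) refl (partial x j) (y * A) ⟩
      partial x j ∎
    where A = partial (x + y) j

  partial-0 : ∀ j → partial 0ℚ j ≡ 1ℚ
  partial-0 zero    = refl
  partial-0 (suc j) = begin-equality
    partial 0ℚ j + term 0ℚ j * (0ℚ * 1/[1+ j ])   ≡⟨ cong₂ (λ a b → a + term 0ℚ j * b) (partial-0 j) (ℚₚ.*-zeroˡ 1/[1+ j ]) ⟩
    1ℚ + term 0ℚ j * 0ℚ                          ≡⟨ cong (λ w → 1ℚ + w) (ℚₚ.*-zeroʳ (term 0ℚ j)) ⟩
    1ℚ + 0ℚ                                      ≡⟨ ℚₚ.+-identityʳ 1ℚ ⟩
    1ℚ                                           ∎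

  0≤^ℚ : ∀ {q} → 0ℚ ≤ q → ∀ N → 0ℚ ≤ q ^ℚ N
  0≤^ℚ 0≤q zero    = 0≤1
  0≤^ℚ 0≤q (suc N) = 0≤* 0≤q (0≤^ℚ 0≤q N)

  [1-y]^N*partial[N*y]≤1 : ∀ {y} → 0ℚ ≤ y → 0ℚ ≤ 1ℚ - y → ∀ N j → ((1ℚ - y) ^ℚ N) * partial (fromℕ N * y) j ≤ 1ℚ
  [1-y]^N*partial[N*y]≤1 {y} 0≤y 0≤1-y zero j = ℚₚ.≤-reflexive (begin-equality
    1ℚ * partial (0ℚ * y) j    ≡⟨ ℚₚ.*-identityˡ _ ⟩
    partial (0ℚ * y) j         ≡⟨ cong (λ q → partial q j) (ℚₚ.*-zeroˡ y) ⟩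
    partial 0ℚ j               ≡⟨ partial-0 j ⟩
    1ℚ                         ∎)
  [1-y]^N*partial[N*y]≤1 {y} 0≤y 0≤1-y (suc N) j = begin
      ((1ℚ - y) * P) * partial (fromℕ (suc N) * y) j
    ≡⟨ cong (λ q → ((1ℚ - y) * P) * partial q j) (fromℕ-suc-* N y) ⟩
      ((1ℚ - y) * P) * partial (fromℕ N * y + y) j
    ≡⟨ solve 3 (λ a b c → (a :* b) :* c := b :* (a :* c)) refl (1ℚ - y) P (partial (fromℕ N * y + y) j) ⟩
      P * ((1ℚ - y) * partial (fromℕ N * y + y) j)
    ≤⟨ *-monoˡ-≤-0≤ (0≤^ℚ 0≤1-y N) ([1-y]*partial[x+y]≤partial[x] (0≤* (0≤fromℕ N) 0≤y) 0≤y j) ⟩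
      P * partial (fromℕ N * y) j
    ≤⟨ [1-y]^N*partial[N*y]≤1 0≤y 0≤1-y N j ⟩
      1ℚ ∎
    where P = (1ℚ - y) ^ℚ N

  [1-s]^N≤exp- : ∀ a N {s} → 0ℚ ≤ s → s ≤ 1ℚ → fromℕ a ≤ fromℕ N * s → ((1ℚ - s) ^ℚ N) ≤exp- a
  [1-s]^N≤exp- a N {s} 0≤s s≤1 a≤N*s j = begin
      P * expPartial a j
    ≡⟨ cong (P *_) (expPartial≡partial a j) ⟩
      P * partial (fromℕ a) j
    ≤⟨ *-monoˡ-≤-0≤ (0≤^ℚ 0≤1-s N) (partial-mono-≤ (0≤fromℕ a) a≤N*s j) ⟩
      P * partial (fromℕ N * s) j
    ≤⟨ [1-y]^N*partial[N*y]≤1 0≤s 0≤1-s N j ⟩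
      1ℚ ∎
    where
    P = (1ℚ - s) ^ℚ N
    0≤1-s : 0ℚ ≤ 1ℚ - s
    0≤1-s = begin 0ℚ ≡⟨ ℚₚ.+-inverseʳ s ⟨ s - s ≤⟨ ℚₚ.+-monoˡ-≤ (- s) s≤1 ⟩ 1ℚ - s ∎

  [1-1]^N≤exp- : ∀ a N → 1 ℕ.≤ N → ((1ℚ - 1ℚ) ^ℚ N) ≤exp- a
  [1-1]^N≤exp- a (suc N) _ j = ℚₚ.≤-trans (ℚₚ.≤-reflexive (begin-equality
      ((1ℚ - 1ℚ) * ((1ℚ - 1ℚ) ^ℚ N)) * expPartial a j   ≡⟨ cong (λ z → (z * (z ^ℚ N)) * expPartial a j) (ℚₚ.+-inverseʳ 1ℚ) ⟩
      (0ℚ * (0ℚ ^ℚ N)) * expPartial a j                 ≡⟨ cong (_* expPartial a j) (ℚₚ.*-zeroˡ (0ℚ ^ℚ N)) ⟩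
      0ℚ * expPartial a j                               ≡⟨ ℚₚ.*-zeroˡ (expPartial a j) ⟩
      0ℚ                                                ∎)) 0≤1

open import Data.Nat using (ℕ; _≤_; _*_; _^_; _+_)
open import Data.Nat.Divisibility using (_∣_)
open import Data.Rational using (1ℚ; _-_)
open ExpSeries using ([1-1]^N≤exp-; [1-s]^N≤exp-)

theorem2p3 :
    (t c : ℕ) → 1 ≤ t → 1 ≤ c →
    (n m : ℕ) (ends : Fin m → Fin n × Fin n) (T : Fin t → Subset n) →
    ((i : Fin t) → 2 ∣ (∣ T i ∣)) →
    (k : ℕ) →
    Σ (Subset m) (λ C → IsEvenCut (inst ⊤ ends T) C × ∣ C ∣ ≡ k) →
    ((C : Subset m) → IsEvenCut (inst ⊤ ends T) C → k ≤ ∣ C ∣) →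
    (search : Search m t) →
    (∀ {n'} (I : Inst m t n') → n' ≤ 2 ^ t + 4 →
      Σ (Subset m) (λ C → IsEvenCut I C) → IsMinEvenCut I (search I)) →
    (good? : (C : Subset m) → Dec (IsEvenCut (inst ⊤ ends T) C × ∣ C ∣ ≡ k)) →
    ((1ℚ - successProb (λ C → IsEvenCut (inst ⊤ ends T) C × ∣ C ∣ ≡ k)
                       good? search n (inst ⊤ ends T))
       ^ℚ (c * n ^ 4)) ≤exp- (24 * c)
theorem2p3 t c _ 1≤c n m ends T _ k (C₀ , C₀-cut , ∣C₀∣≡k) k≤cuts search search-min good? with n ℕ.≤? 2 ^ t + 4
... | yes small = subst (λ s → ((1ℚ - s) ^ℚ N) ≤exp- (24 * c)) (sym (success≡1 n original small faithful-original))
                        ([1-1]^N≤exp- (24 * c) N (ℕₚ.*-mono-≤ 1≤c (ℕₚ.^-monoˡ-≤ 4 1≤n)))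
  where
  open RandomContraction ends T k C₀ C₀-cut ∣C₀∣≡k k≤cuts search search-min good?
  N = c * n ^ 4
... | no large = [1-s]^N≤exp- (24 * c) (c * n ^ 4) (proj₁ (success-InUnit n original)) (proj₂ (success-InUnit n original))
                              (24c≤cn⁴*success c (ℕₚ.<⇒≤ (ℕₚ.≰⇒> large)))
  where open RandomContraction ends T k C₀ C₀-cut ∣C₀∣≡k k≤cuts search search-min good?
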